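{- Let $k\geq1$ and let $\mathrm{PM}_k^+$ be the span of the $\mathbf F_M$ with $M\neq\emptyset$. For every nonempty $k$-packed $M$, $\Delta(\mathbf F_M)=\mathbf F_\emptyset\otimes\mathbf F_M+\Delta_\prec(\mathbf F_M)+\Delta_\succ(\mathbf F_M)+\mathbf F_M\otimes\mathbf F_\emptyset$, and, with $\bar\Delta=\Delta_\prec+\Delta_\succ$ and $I$ the identity map, the following hold on $\mathrm{PM}_k^+$: \[(\Delta_\prec\otimes I)\circ\Delta_\prec=(I\otimes\bar\Delta)\circ\Delta_\prec,\quad(\Delta_\succ\otimes I)\circ\Delta_\prec=(I\otimes\Delta_\prec)\circ\Delta_\succ,\quad(\bar\Delta\otimes I)\circ\Delta_\succ=(I\otimes\Delta_\succ)\circ\Delta_\succ.\] That is, $(\mathrm{PM}_k^+,\Delta_\prec,\Delta_\succ)$ is a codendriform coalgebra whose associated coproduct is the reduced coproduct of $\mathrm{PM}_k$.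
   Context: Let $A_k=\{0,1,\dots,k\}$. A $k$-packed matrix of size $n\geq0$ is an $n\times n$ matrix with entries in $A_k$ such that every row and every column contains a nonzero entry; $\emptyset$ is the one of size $0$. $\mathrm{PM}_k$ is the vector space over a field of characteristic zero with basis $\{\mathbf F_M\}$ indexed by $k$-packed matrices. The compression $\mathrm{cp}(N)$ of a matrix deletes all its zero rows and zero columns. For $M$ of size $n$ and $0\le j\le n$, writing $M=[L\mid R]$ with $L$ the first $j$ columns and $R$ the remaining ones, this is a column decomposition $M=L\bullet R$ if $\mathrm{cp}(L)$ and $\mathrm{cp}(R)$ are square; the coproduct is $\Delta(\mathbf F_M)=\sum_{M=L\bullet R}\mathbf F_{\mathrm{cp}(L)}\otimes\mathbf F_{\mathrm{cp}(R)}$. For a nonempty $k$-packed $M$, define $\Delta_\prec(\mathbf F_M)$ (resp. $\Delta_\succ(\mathbf F_M)$) as the sum of $\mathbf F_{\mathrm{cp}(L)}\otimes\mathbf F_{\mathrm{cp}(R)}$ over column decompositions $M=L\bullet R$ in which both $L$ and $R$ have at least one column and the nonzero entries of the last row of $M$ lie in $L$ (resp. in $R$), i.e., the last row of $M$ equals the last row of $L$ padded on the right with zeros (resp. the last row of $R$ padded on the left with zeros); extend linearly. -}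

module Defs where

open import Data.Nat using (ℕ; zero; suc; _∸_; _≡ᵇ_)
open import Data.Fin using (Fin)
open import Data.Bool using (Bool; true; false; not; _∧_)
open import Data.Product using (_×_; _,_; proj₁; proj₂)
open import Data.Maybe using (Maybe; just; nothing)
open import Data.List using (List; []; _∷_; _++_; map; concatMap; filterᵇ;
  length; take; drop; zip; upTo; last; head)
open import Data.Bool.ListAction using (all; any)
open import Relation.Binary.PropositionalEquality using (_≡_)
open import Data.List.Relation.Binary.Permutation.Propositional using (_↭_)

-- Matrices with entries in A_k = {0,…,k}, represented as Fin (suc k),
-- stored as a list of rows (each row a list of entries).

Entry : ℕ → Set
Entry k = Fin (suc k)

Mat : ℕ → Set
Mat k = List (List (Entry k))

module _ {k : ℕ} where

  nonzero : Entry k → Bool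
  nonzero Fin.zero    = false
  nonzero (Fin.suc _) = true

  nonzeroRow : List (Entry k) → Bool
  nonzeroRow = any nonzero

  nonzeroAt : List (Entry k) → ℕ → Bool
  nonzeroAt r i with head (drop i r)
  ... | just x  = nonzero x
  ... | nothing = false

  nonzeroCol : Mat k → ℕ → Bool
  nonzeroCol N i = any (λ r → nonzeroAt r i) N

  width : Mat k → ℕ
  width []      = 0
  width (r ∷ _) = length r

  -- compression: delete all zero rows and all zero columns
  cp : Mat k → Mat k
  cp N = map keep (filterᵇ nonzeroRow N)
    where
    keep : List (Entry k) → List (Entry k)
    keep r = map proj₂ (filterᵇ (λ p → nonzeroCol N (proj₁ p)) (zip (upTo (length r)) r))

  isSquare : Mat k → Bool
  isSquare N = length N ≡ᵇ width N

  zeroRow : List (Entry k) → Bool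
  zeroRow r = not (nonzeroRow r)

  lastRow : Mat k → List (Entry k)
  lastRow N with last N
  ... | just r  = r
  ... | nothing = []

  leftCols : ℕ → Mat k → Mat k
  leftCols j = map (take j)

  rightCols : ℕ → Mat k → Mat k
  rightCols j = map (drop j)

  isColDec : Mat k → ℕ → Bool
  isColDec M j = isSquare (cp (leftCols j M)) ∧ isSquare (cp (rightCols j M))

  cpPair : Mat k → ℕ → Mat k × Mat k
  cpPair M j = cp (leftCols j M) , cp (rightCols j M)

record Packed (k : ℕ) (M : Mat k) : Set where
  field
    rowsLength : all (λ r → length r ≡ᵇ length M) M ≡ true
    rowsNZ     : all nonzeroRow M ≡ true
    colsNZ     : all (nonzeroCol M) (upTo (length M)) ≡ true

-- Elements of PM_k ⊗ PM_k and PM_k ⊗ PM_k ⊗ PM_k that are sums of basis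
-- tensors (with multiplicity) are represented by lists of basis indices.

Tensor2 : ℕ → Set
Tensor2 k = List (Mat k × Mat k)

Tensor3 : ℕ → Set
Tensor3 k = List (Mat k × Mat k × Mat k)

module _ {k : ℕ} where

  allSplits : Mat k → List ℕ
  allSplits M = upTo (suc (length M))

  innerSplits : Mat k → List ℕ
  innerSplits M = map suc (upTo (length M ∸ 1))

  Δ : Mat k → Tensor2 k
  Δ M = map (cpPair M) (filterᵇ (isColDec M) (allSplits M))

  -- Δ≺(F_M): nonzero entries of the last row of M lie in L,
  -- i.e. the last row of R is zero
  Δ≺ : Mat k → Tensor2 k
  Δ≺ M = map (cpPair M)
    (filterᵇ (λ j → isColDec M j ∧ zeroRow (lastRow (rightCols j M))) (innerSplits M))

  -- Δ≻(F_M): nonzero entries of the last row of M lie in R,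
  -- i.e. the last row of L is zero
  Δ≻ : Mat k → Tensor2 k
  Δ≻ M = map (cpPair M)
    (filterᵇ (λ j → isColDec M j ∧ zeroRow (lastRow (leftCols j M))) (innerSplits M))

  Δ̄ : Mat k → Tensor2 k
  Δ̄ M = Δ≺ M ++ Δ≻ M

  _⊗I : (Mat k → Tensor2 k) → Tensor2 k → Tensor3 k
  (f ⊗I) t = concatMap (λ p → map (λ q → proj₁ q , proj₂ q , proj₂ p) (f (proj₁ p))) t

  I⊗_ : (Mat k → Tensor2 k) → Tensor2 k → Tensor3 k
  (I⊗ f) t = concatMap (λ p → map (λ q → proj₁ p , proj₁ q , proj₂ q) (f (proj₂ p))) t

  -- equality of ℕ-linear combinations of basis tensors (over a field of
  -- characteristic 0): equal multiplicities, i.e. the lists are permutations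
  _≈₂_ : Tensor2 k → Tensor2 k → Set
  _≈₂_ = _↭_

  _≈₃_ : Tensor3 k → Tensor3 k → Set
  _≈₃_ = _↭_

  ∅ : Mat k
  ∅ = []

-- Both sides of each codendriform identity are sums of F_A ⊗ F_B ⊗ F_C over the cuts of M into three
-- consecutive column blocks A | B | C, read either as a cut of cp(A | B) after a cut of M, or as a cut of
-- cp(B | C) after a cut of M. Since every row of M has a nonzero entry, counting nonzero rows shows that
-- cp(A), cp(B), cp(C) are square exactly when cp(A | B), cp(C) are, and exactly when cp(A), cp(B | C) are;
-- so the two readings range over the same triples, and the conditions ≺ / ≻ on both sides only depend on
-- which of A, B, C the last row of M meets. The same counting shows that at a column decomposition the
-- last row is nonzero on exactly one side, which gives Δ = ∅ ⊗ M + Δ≺ + Δ≻ + M ⊗ ∅.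

module Submission where

open import Algebra.Bundles using (CommutativeMonoid)
open import Data.Bool using (Bool; true; false; _∧_; _∨_; not; if_then_else_; T; T?)
open import Data.Bool.ListAction using (all)
open import Data.Bool.Properties using (¬-not; ∨-assoc; ∨-zeroʳ; ∧-zeroʳ; ∧-identityʳ; ∧-commutativeMonoid; T-≡)
open import Algebra.Properties.CommutativeSemigroup (CommutativeMonoid.commutativeSemigroup ∧-commutativeMonoid)
  using (interchange)
open import Data.Empty using (⊥-elim)
open import Data.List using (List; []; _∷_; [_]; _++_; map; concatMap; filterᵇ; length; upTo; applyUpTo; take; drop; zip; head; last)
open import Data.List.Properties
open import Data.List.Membership.Propositional.Properties using (∈-upTo⁺)
open import Data.List.Relation.Unary.All as All using (All; []; _∷_)
import Data.List.Relation.Unary.All.Properties as All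
open import Data.List.Relation.Binary.Permutation.Propositional
  using (_↭_; ↭-refl; ↭-trans; ↭-sym; ↭-reflexive; prep; module PermutationReasoning)
open import Data.List.Relation.Binary.Permutation.Propositional.Properties using (++⁺; ++⁺ˡ; ++⁺ʳ; shifts; shift; map⁺)
open import Data.Maybe as Maybe using (Maybe; just; nothing)
open import Data.Nat using (ℕ; zero; suc; _+_; _∸_; _≤_; _<_; _≤ᵇ_; _<ᵇ_; _≡ᵇ_; _⊓_; z≤n; s≤s; z<s)
open import Data.Nat.Properties
open import Data.Product using (_×_; _,_; proj₁; proj₂)
open import Function using (_∘_; case_of_)
open import Function.Bundles using (module Equivalence)
open import Relation.Binary.PropositionalEquality hiding ([_])
open import Relation.Nullary using (yes; no)

open import Defs

private variable
  A B C : Set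

T⇒≡true : ∀ {b} → T b → b ≡ true
T⇒≡true = Equivalence.to T-≡

≡true⇒T : ∀ {b} → b ≡ true → T b
≡true⇒T = Equivalence.from T-≡

∧≡true⇒ : ∀ {a b} → (a ∧ b) ≡ true → (a ≡ true) × (b ≡ true)
∧≡true⇒ {true} {true} refl = refl , refl

∨≡true-∧≡false⇒ : ∀ {a b} → (a ∨ b) ≡ true → (a ∧ b) ≡ false → a ≡ not b
∨≡true-∧≡false⇒ {true}  {false} _ _ = refl
∨≡true-∧≡false⇒ {false} {true}  _ _ = refl

≡true⇔≡true⇒≡ : ∀ {a b} → (a ≡ true → b ≡ true) → (b ≡ true → a ≡ true) → a ≡ b
≡true⇔≡true⇒≡ {true}  a⇒b _   = sym (a⇒b refl)
≡true⇔≡true⇒≡ {false} {true}  _ b⇒a = b⇒a refl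
≡true⇔≡true⇒≡ {false} {false} _ _   = refl

∧-cong-guarded : ∀ {a a′ b b′} → a ≡ a′ → (a ≡ true → b ≡ b′) → (a ∧ b) ≡ (a′ ∧ b′)
∧-cong-guarded {true}  refl b≡b′ = b≡b′ refl
∧-cong-guarded {false} refl _    = refl

∧-assoc-squares : ∀ {a b c ab bc} → (a ≡ true → b ≡ true → c ≡ true → (ab ≡ true) × (bc ≡ true)) →
  ((ab ∧ c) ∧ (a ∧ b)) ≡ ((a ∧ bc) ∧ (b ∧ c))
∧-assoc-squares {true}  {true}  {true}            compose with compose refl refl refl
... | refl , refl = refl
∧-assoc-squares {false} {_}     {_}     {ab}      _ = ∧-zeroʳ (ab ∧ _)
∧-assoc-squares {true}  {false} {_}     {ab} {bc} _ = trans (∧-zeroʳ (ab ∧ _)) (sym (∧-zeroʳ bc))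
∧-assoc-squares {true}  {true}  {false} {ab} {bc} _ = trans (cong (_∧ true) (∧-zeroʳ ab)) (sym (∧-zeroʳ bc))

≡ᵇ≡true⇒ : ∀ m n → (m ≡ᵇ n) ≡ true → m ≡ n
≡ᵇ≡true⇒ m n e = ≡ᵇ⇒≡ m n (≡true⇒T e)

≡⇒≡ᵇ≡true : ∀ {m n} → m ≡ n → (m ≡ᵇ n) ≡ true
≡⇒≡ᵇ≡true {m} {n} e = T⇒≡true (≡⇒≡ᵇ m n e)

when : Bool → List A → List A
when true  xs = xs
when false _  = []

filterᵇ-∷ : (p : A → Bool) (x : A) (xs : List A) →
  filterᵇ p (x ∷ xs) ≡ (if p x then x ∷ filterᵇ p xs else filterᵇ p xs)
filterᵇ-∷ p x xs with p x
... | true  = refl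
... | false = refl

filterᵇ-cong : {p q : A → Bool} → (∀ x → p x ≡ q x) → (xs : List A) → filterᵇ p xs ≡ filterᵇ q xs
filterᵇ-cong p≗q [] = refl
filterᵇ-cong {p = p} {q} p≗q (x ∷ xs)
  rewrite filterᵇ-∷ p x xs | filterᵇ-∷ q x xs | p≗q x | filterᵇ-cong p≗q xs = refl

concatMap-filterᵇ : (f : A → List B) (p : A → Bool) (xs : List A) →
  concatMap f (filterᵇ p xs) ≡ concatMap (λ x → when (p x) (f x)) xs
concatMap-filterᵇ f p [] = refl
concatMap-filterᵇ f p (x ∷ xs) rewrite filterᵇ-∷ p x xs with p x
... | true  = cong (f x ++_) (concatMap-filterᵇ f p xs)
... | false = concatMap-filterᵇ f p xs

map≡concatMap-[_] : (f : A → B) (xs : List A) → map f xs ≡ concatMap (λ x → [ f x ]) xs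
map≡concatMap-[_] f []       = refl
map≡concatMap-[_] f (x ∷ xs) = cong (f x ∷_) (map≡concatMap-[_] f xs)

concatMap-[] : (xs : List A) → concatMap {B = B} (λ _ → []) xs ≡ []
concatMap-[] []       = refl
concatMap-[] (_ ∷ xs) = concatMap-[] xs

when-when : (a b : Bool) (xs : List A) → when a (when b xs) ≡ when (a ∧ b) xs
when-when true  b xs = refl
when-when false b xs = refl

when-cong : (a : Bool) {xs ys : List A} → (a ≡ true → xs ≡ ys) → when a xs ≡ when a ys
when-cong true  xs≡ys = xs≡ys refl
when-cong false _     = refl

concatMap-when-cong : {g : A → Bool} {f f′ : A → List B} →
  (∀ x → g x ≡ true → f x ≡ f′ x) → (xs : List A) →
  concatMap (λ x → when (g x) (f x)) xs ≡ concatMap (λ x → when (g x) (f′ x)) xs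
concatMap-when-cong {g = g} {f} {f′} f≗f′ = concatMap-cong guarded
  where
  guarded : ∀ x → when (g x) (f x) ≡ when (g x) (f′ x)
  guarded x with g x in gx
  ... | true  = f≗f′ x gx
  ... | false = refl

concatMap-when-↭ : {g : A → Bool} {f f′ : A → List B} →
  (∀ x → g x ≡ true → f x ↭ f′ x) → (xs : List A) →
  concatMap (λ x → when (g x) (f x)) xs ↭ concatMap (λ x → when (g x) (f′ x)) xs
concatMap-when-↭ f↭f′ []       = ↭-refl
concatMap-when-↭ {g = g} f↭f′ (x ∷ xs) = ++⁺ guarded (concatMap-when-↭ f↭f′ xs)
  where
  guarded : when (g x) _ ↭ when (g x) _
  guarded with g x in gx
  ... | true  = f↭f′ x gx
  ... | false = ↭-refl

concatMap-when-true : {g : A → Bool} (f : A → List B) {xs : List A} →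
  All (λ x → g x ≡ true) xs → concatMap (λ x → when (g x) (f x)) xs ≡ concatMap f xs
concatMap-when-true f []              = refl
concatMap-when-true f (gx ∷ gxs) rewrite gx = cong (f _ ++_) (concatMap-when-true f gxs)

concatMap-when-false : {g : A → Bool} (f : A → List B) {xs : List A} →
  All (λ x → g x ≡ false) xs → concatMap (λ x → when (g x) (f x)) xs ≡ []
concatMap-when-false f []              = refl
concatMap-when-false f (gx ∷ gxs) rewrite gx = concatMap-when-false f gxs

when-concatMap-when : (a : Bool) (g : A → Bool) (f : A → List B) (xs : List A) →
  when a (concatMap (λ x → when (g x) (f x)) xs) ≡ concatMap (λ x → when (a ∧ g x) (f x)) xs
when-concatMap-when true  g f xs = refl
when-concatMap-when false g f xs = sym (concatMap-[] xs)

concatMap-++-↭ : (f g : A → List B) (xs : List A) →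
  concatMap (λ x → f x ++ g x) xs ↭ concatMap f xs ++ concatMap g xs
concatMap-++-↭ f g []       = ↭-refl
concatMap-++-↭ f g (x ∷ xs) = begin
  (f x ++ g x) ++ concatMap (λ x → f x ++ g x) xs  ≡⟨ ++-assoc (f x) (g x) _ ⟩
  f x ++ g x ++ concatMap (λ x → f x ++ g x) xs    ↭⟨ ++⁺ˡ (f x) (++⁺ˡ (g x) (concatMap-++-↭ f g xs)) ⟩
  f x ++ g x ++ concatMap f xs ++ concatMap g xs   ↭⟨ ++⁺ˡ (f x) (shifts (g x) (concatMap f xs)) ⟩
  f x ++ concatMap f xs ++ g x ++ concatMap g xs   ≡⟨ ++-assoc (f x) (concatMap f xs) _ ⟨
  (f x ++ concatMap f xs) ++ g x ++ concatMap g xs ∎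
  where open PermutationReasoning

concatMap-comm : (f : A → B → List C) (xs : List A) (ys : List B) →
  concatMap (λ y → concatMap (λ x → f x y) xs) ys ↭ concatMap (λ x → concatMap (λ y → f x y) ys) xs
concatMap-comm f xs []       = ↭-reflexive (sym (concatMap-[] xs))
concatMap-comm f xs (y ∷ ys) =
  ↭-trans (++⁺ˡ (concatMap (λ x → f x y) xs) (concatMap-comm f xs ys))
          (↭-sym (concatMap-++-↭ (λ x → f x y) (λ x → concatMap (λ y → f x y) ys) xs))

filterᵇ-∧-partition : (p a b : A → Bool) (xs : List A) → All (λ x → p x ≡ true → b x ≡ not (a x)) xs →
  filterᵇ (λ x → p x ∧ a x) xs ++ filterᵇ (λ x → p x ∧ b x) xs ↭ filterᵇ (λ x → p x ∧ true) xs
filterᵇ-∧-partition p a b []       []           = ↭-refl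
filterᵇ-∧-partition p a b (x ∷ xs) (b≡¬a ∷ rest)
  rewrite filterᵇ-∷ (λ x → p x ∧ a x) x xs | filterᵇ-∷ (λ x → p x ∧ b x) x xs | filterᵇ-∷ (λ x → p x ∧ true) x xs
  with p x
... | false = filterᵇ-∧-partition p a b xs rest
... | true with a x | b x | b≡¬a refl
...   | true  | false | _ = prep x (filterᵇ-∧-partition p a b xs rest)
...   | false | true  | _ = ↭-trans (shift x (filterᵇ (λ x → p x ∧ a x) xs) _) (prep x (filterᵇ-∧-partition p a b xs rest))

all≡true⇒ : {p : A → Bool} {xs : List A} → all p xs ≡ true → All (λ x → p x ≡ true) xs
all≡true⇒ {p = p} {xs} e = All.map T⇒≡true (All.all⁺ p xs (≡true⇒T e))

≢[]⇒1≤length : {xs : List A} → xs ≢ [] → 1 ≤ length xs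
≢[]⇒1≤length {xs = []}    xs≢[] = ⊥-elim (xs≢[] refl)
≢[]⇒1≤length {xs = _ ∷ _} _     = s≤s z≤n

take-take-≤ : ∀ {i j} → i ≤ j → (xs : List A) → take i (take j xs) ≡ take i xs
take-take-≤ {i = i} {j = j} i≤j xs = trans (take-take i j xs) (cong (λ m → take m xs) (m≤n⇒m⊓n≡m i≤j))

drop-take-≤ : ∀ {i j} → i ≤ j → (xs : List A) → drop i (take j xs) ≡ take (j ∸ i) (drop i xs)
drop-take-≤ {i = i} {j = j} i≤j xs = sym (trans (take-drop (j ∸ i) i xs) (cong (λ m → drop i (take m xs)) (m+[n∸m]≡n i≤j)))

drop-drop-≤ : ∀ {i j} → i ≤ j → (xs : List A) → drop (j ∸ i) (drop i xs) ≡ drop j xs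
drop-drop-≤ {i = i} {j = j} i≤j xs = trans (drop-drop i (j ∸ i) xs) (cong (λ m → drop m xs) (m+[n∸m]≡n i≤j))

map-proj₂-filterᵇ-zip : (P : A → Bool) (xs : List A) (ys : List B) →
  All (λ x → P x ≡ true) xs → length ys ≤ length xs →
  map proj₂ (filterᵇ (P ∘ proj₁) (zip xs ys)) ≡ ys
map-proj₂-filterᵇ-zip P []       []       _          _         = refl
map-proj₂-filterᵇ-zip P (_ ∷ _)  []       _          _         = refl
map-proj₂-filterᵇ-zip P (x ∷ xs) (y ∷ ys) (Px ∷ Pxs) (s≤s len≤)
  rewrite filterᵇ-∷ (P ∘ proj₁) (x , y) (zip xs ys) | Px = cong (y ∷_) (map-proj₂-filterᵇ-zip P xs ys Pxs len≤)

last-∷ : (y : A) {x : A} (ys : List A) → last ys ≡ just x → last (y ∷ ys) ≡ just x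
last-∷ y (_ ∷ _) e = e

last-filterᵇ : (p : A → Bool) {x : A} (xs : List A) → last xs ≡ just x → p x ≡ true → last (filterᵇ p xs) ≡ just x
last-filterᵇ p (y ∷ [])     refl px rewrite filterᵇ-∷ p y [] | px = refl
last-filterᵇ p {x} (y ∷ z ∷ xs) eq px with p y | last-filterᵇ p (z ∷ xs) eq px
... | false | ih = ih
... | true  | ih = last-∷ y (filterᵇ p (z ∷ xs)) ih

range : ℕ → ℕ → List ℕ
range s zero    = []
range s (suc l) = s ∷ range (suc s) l

map-+-range : ∀ a s l → map (a +_) (range s l) ≡ range (a + s) l
map-+-range a s zero    = refl
map-+-range a s (suc l) = cong (a + s ∷_) (trans (map-+-range a (suc s) l) (cong (λ t → range t l) (+-suc a s)))

range-++ : ∀ s a b → range s (a + b) ≡ range s a ++ range (s + a) b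
range-++ s zero    b = cong (λ t → range t b) (sym (+-identityʳ s))
range-++ s (suc a) b = cong (s ∷_) (trans (range-++ (suc s) a b) (cong (λ t → range (suc s) a ++ range t b) (sym (+-suc s a))))

range-bounds : ∀ s l → All (λ x → s ≤ x × x < s + l) (range s l)
range-bounds s zero    = []
range-bounds s (suc l) = (≤-refl , subst (s <_) (sym (+-suc s l)) (s≤s (m≤m+n s l)))
  ∷ All.map (λ {x} (s<x , x<) → <⇒≤ s<x , subst (x <_) (sym (+-suc s l)) x<) (range-bounds (suc s) l)

range-∷ʳ : ∀ s l → range s (suc l) ≡ range s l ++ [ s + l ]
range-∷ʳ s zero    = cong [_] (sym (+-identityʳ s))
range-∷ʳ s (suc l) = cong (s ∷_) (trans (range-∷ʳ (suc s) l) (cong (λ m → range (suc s) l ++ [ m ]) (sym (+-suc s l))))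

range-1-∷ʳ : ∀ {n} → 1 ≤ n → range 1 n ≡ range 1 (n ∸ 1) ++ [ n ]
range-1-∷ʳ {suc n} _ = range-∷ʳ 1 n

applyUpTo≡map-range : (f : ℕ → A) (l : ℕ) → applyUpTo f l ≡ map f (range 0 l)
applyUpTo≡map-range f zero    = refl
applyUpTo≡map-range f (suc l) = cong (f 0 ∷_) (begin
  applyUpTo (f ∘ suc) l       ≡⟨ applyUpTo≡map-range (f ∘ suc) l ⟩
  map (f ∘ suc) (range 0 l)   ≡⟨ map-∘ (range 0 l) ⟩
  map f (map suc (range 0 l)) ≡⟨ cong (map f) (map-+-range 1 0 l) ⟩
  map f (range 1 l)           ∎)
  where open ≡-Reasoning

upTo≡range : ∀ l → upTo l ≡ range 0 l
upTo≡range l = trans (applyUpTo≡map-range (λ x → x) l) (map-id (range 0 l))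

inRange : ℕ → ℕ → ℕ → Bool
inRange s l x = (s ≤ᵇ x) ∧ (x <ᵇ s + l)

inRange⇒ : ∀ {s l x} → inRange s l x ≡ true → s ≤ x × x < s + l
inRange⇒ {s} {l} {x} e with ∧≡true⇒ {s ≤ᵇ x} e
... | s≤ᵇx , x<ᵇ = ≤ᵇ⇒≤ s x (≡true⇒T s≤ᵇx) , <ᵇ⇒< x (s + l) (≡true⇒T x<ᵇ)

inRange⁺ : ∀ {s l x} → s ≤ x → x < s + l → inRange s l x ≡ true
inRange⁺ {s} {l} {x} s≤x x< rewrite T⇒≡true (≤⇒≤ᵇ s≤x) | T⇒≡true (<⇒<ᵇ x<) = refl

concatMap-subrange : (g : ℕ → List A) (s l n : ℕ) → s + l ≤ n →
  concatMap g (range s l) ≡ concatMap (λ x → when (inRange s l x) (g x)) (range 0 n)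
concatMap-subrange g s l n s+l≤n = sym (begin
  concatMap G (range 0 n)
    ≡⟨ cong (concatMap G) (trans (cong (range 0) (sym n≡)) (trans (range-++ 0 s (l + r)) (cong (range 0 s ++_) (range-++ s l r)))) ⟩
  concatMap G (range 0 s ++ range s l ++ range (s + l) r)
    ≡⟨ trans (concatMap-++ G (range 0 s) _) (cong (concatMap G (range 0 s) ++_) (concatMap-++ G (range s l) _)) ⟩
  concatMap G (range 0 s) ++ concatMap G (range s l) ++ concatMap G (range (s + l) r)
    ≡⟨ cong₂ (λ u v → u ++ concatMap G (range s l) ++ v) below above ⟩
  concatMap G (range s l) ++ []
    ≡⟨ trans (++-identityʳ _) (concatMap-when-true g (All.map (λ (s≤x , x<) → inRange⁺ s≤x x<) (range-bounds s l))) ⟩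
  concatMap g (range s l) ∎)
  where
  open ≡-Reasoning
  G = λ x → when (inRange s l x) (g x)
  r = n ∸ (s + l)
  n≡ : s + (l + r) ≡ n
  n≡ = trans (sym (+-assoc s l r)) (m+[n∸m]≡n s+l≤n)
  below : concatMap G (range 0 s) ≡ []
  below = concatMap-when-false g (All.map (λ (_ , x<s) → ¬-not (λ e → <⇒≱ x<s (proj₁ (inRange⇒ {s} {l} e)))) (range-bounds 0 s))
  above : concatMap G (range (s + l) r) ≡ []
  above = concatMap-when-false g (All.map (λ (s+l≤x , _) → ¬-not (λ e → <⇒≱ (proj₂ (inRange⇒ {s} {l} e)) s+l≤x)) (range-bounds (s + l) r))

concatMap-shift : (f : ℕ → List A) (s a l : ℕ) → concatMap (λ j → f (j ∸ s)) (range (s + a) l) ≡ concatMap f (range a l)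
concatMap-shift f s a l = begin
  concatMap (λ j → f (j ∸ s)) (range (s + a) l)           ≡⟨ cong (concatMap (λ j → f (j ∸ s))) (map-+-range s a l) ⟨
  concatMap (λ j → f (j ∸ s)) (map (s +_) (range a l))    ≡⟨ concatMap-map (λ j → f (j ∸ s)) (s +_) (range a l) ⟩
  concatMap (λ j → f (s + j ∸ s)) (range a l)             ≡⟨ concatMap-cong (λ j → cong f (m+n∸m≡n s j)) (range a l) ⟩
  concatMap f (range a l)                                 ∎
  where open ≡-Reasoning

inRange-suc⇒ : ∀ {s w j} → inRange (s + 1) (w ∸ 1) j ≡ true → s < j × j < s + w
inRange-suc⇒ {s} {zero} {j} e with inRange⇒ {s + 1} {0} e
... | s+1≤j , j< = ⊥-elim (<⇒≱ (subst (j <_) (+-identityʳ (s + 1)) j<) s+1≤j)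
inRange-suc⇒ {s} {suc w} {j} e with inRange⇒ {s + 1} {w} e
... | s+1≤j , j< = subst (_≤ j) (+-comm s 1) s+1≤j , subst (j <_) (+-assoc s 1 w) j<

inRange-suc⁺ : ∀ {s w j} → s < j → j < s + w → inRange (s + 1) (w ∸ 1) j ≡ true
inRange-suc⁺ {s} {zero}  {j} s<j j<s+0 = ⊥-elim (<-asym s<j (subst (j <_) (+-identityʳ s) j<s+0))
inRange-suc⁺ {s} {suc w} {j} s<j j<   = inRange⁺ (subst (_≤ j) (+-comm 1 s) s<j) (subst (j <_) (sym (+-assoc s 1 w)) j<)

<1+[n∸1]⇒< : ∀ {i n} → 1 ≤ i → i < 1 + (n ∸ 1) → i < n
<1+[n∸1]⇒< {n = zero}  1≤i i<1 = ⊥-elim (<⇒≱ i<1 1≤i)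
<1+[n∸1]⇒< {n = suc n} _   i<  = i<

-- Counting

bit : Bool → ℕ
bit true  = 1
bit false = 0

count : (A → Bool) → List A → ℕ
count p []       = 0
count p (x ∷ xs) = bit (p x) + count p xs

length-filterᵇ : (p : A → Bool) (xs : List A) → length (filterᵇ p xs) ≡ count p xs
length-filterᵇ p []       = refl
length-filterᵇ p (x ∷ xs) rewrite filterᵇ-∷ p x xs with p x
... | true  = cong suc (length-filterᵇ p xs)
... | false = length-filterᵇ p xs

count-map : (p : B → Bool) (f : A → B) (xs : List A) → count p (map f xs) ≡ count (p ∘ f) xs
count-map p f []       = refl
count-map p f (x ∷ xs) = cong (bit (p (f x)) +_) (count-map p f xs)

count-cong : {p q : A → Bool} → (∀ x → p x ≡ q x) → (xs : List A) → count p xs ≡ count q xs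
count-cong p≗q []       = refl
count-cong p≗q (x ∷ xs) = cong₂ _+_ (cong bit (p≗q x)) (count-cong p≗q xs)

count-all : {p : A → Bool} {xs : List A} → All (λ x → p x ≡ true) xs → count p xs ≡ length xs
count-all []           = refl
count-all (px ∷ pxs) rewrite px = cong suc (count-all pxs)

count≡0⇒ : (p : A → Bool) (xs : List A) → count p xs ≡ 0 → All (λ x → p x ≡ false) xs
count≡0⇒ p []       _ = []
count≡0⇒ p (x ∷ xs) e with p x in px
... | false = px ∷ count≡0⇒ p xs e

count-∨+count-∧ : (a b : A → Bool) (xs : List A) →
  count (λ x → a x ∨ b x) xs + count (λ x → a x ∧ b x) xs ≡ count a xs + count b xs
count-∨+count-∧ a b []       = refl
count-∨+count-∧ a b (x ∷ xs) with a x | b x | count-∨+count-∧ a b xs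
... | true  | true  | ih = cong suc (trans (+-suc _ _) (trans (cong suc ih) (sym (+-suc _ _))))
... | true  | false | ih = cong suc ih
... | false | true  | ih = trans (cong suc ih) (sym (+-suc _ _))
... | false | false | ih = ih

count-∨-≤ : (a b : A → Bool) (xs : List A) → count (λ x → a x ∨ b x) xs ≤ count a xs + count b xs
count-∨-≤ a b xs = subst (count (λ x → a x ∨ b x) xs ≤_) (count-∨+count-∧ a b xs) (m≤m+n _ _)

-- Rows, columns and compression

Row : ℕ → Set
Row k = List (Entry k)

module _ {k : ℕ} where

  nonzeroRow-++ : (xs ys : Row k) → nonzeroRow (xs ++ ys) ≡ nonzeroRow xs ∨ nonzeroRow ys
  nonzeroRow-++ []       ys = refl
  nonzeroRow-++ (x ∷ xs) ys = trans (cong (nonzero x ∨_) (nonzeroRow-++ xs ys)) (sym (∨-assoc (nonzero x) _ _))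

  nonzeroRow-take-drop : (i : ℕ) (r : Row k) → nonzeroRow r ≡ nonzeroRow (take i r) ∨ nonzeroRow (drop i r)
  nonzeroRow-take-drop i r = trans (cong nonzeroRow (sym (take++drop≡id i r))) (nonzeroRow-++ (take i r) (drop i r))

  nonzeroRow-take⇒ : (i : ℕ) (r : Row k) → nonzeroRow (take i r) ≡ true → nonzeroRow r ≡ true
  nonzeroRow-take⇒ i r e = trans (nonzeroRow-take-drop i r) (cong (_∨ nonzeroRow (drop i r)) e)

  nonzeroRow-drop⇒ : (i : ℕ) (r : Row k) → nonzeroRow (drop i r) ≡ true → nonzeroRow r ≡ true
  nonzeroRow-drop⇒ i r e = trans (nonzeroRow-take-drop i r) (trans (cong (nonzeroRow (take i r) ∨_) e) (∨-zeroʳ _))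

  nonzeroRow-take-split : ∀ {i j} → i ≤ j → (r : Row k) →
    nonzeroRow (take j r) ≡ nonzeroRow (take i r) ∨ nonzeroRow (take (j ∸ i) (drop i r))
  nonzeroRow-take-split {i} {j} i≤j r = trans (nonzeroRow-take-drop i (take j r))
    (cong₂ (λ u v → nonzeroRow u ∨ nonzeroRow v) (take-take-≤ i≤j r) (drop-take-≤ i≤j r))

  nonzeroRow-drop-split : ∀ {i j} → i ≤ j → (r : Row k) →
    nonzeroRow (drop i r) ≡ nonzeroRow (take (j ∸ i) (drop i r)) ∨ nonzeroRow (drop j r)
  nonzeroRow-drop-split {i} {j} i≤j r = trans (nonzeroRow-take-drop (j ∸ i) (drop i r))
    (cong (λ u → nonzeroRow (take (j ∸ i) (drop i r)) ∨ nonzeroRow u) (drop-drop-≤ i≤j r))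

  nonzeroHead : Maybe (Entry k) → Bool
  nonzeroHead (just x) = nonzero x
  nonzeroHead nothing  = false

  nonzeroAt≡nonzeroHead : (r : Row k) (c : ℕ) → nonzeroAt r c ≡ nonzeroHead (head (drop c r))
  nonzeroAt≡nonzeroHead r c with head (drop c r)
  ... | just _  = refl
  ... | nothing = refl

  nonzeroAt-take : (r : Row k) {c w : ℕ} → c < w → nonzeroAt (take w r) c ≡ nonzeroAt r c
  nonzeroAt-take r {c} {w} c<w = trans (nonzeroAt≡nonzeroHead (take w r) c)
    (trans (cong nonzeroHead (head-drop-take r c<w)) (sym (nonzeroAt≡nonzeroHead r c)))
    where
    head-drop-take : (r : Row k) {c w : ℕ} → c < w → head (drop c (take w r)) ≡ head (drop c r)
    head-drop-take []      {w = suc _} _         = refl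
    head-drop-take (x ∷ r) {zero}  {suc w} _       = refl
    head-drop-take (x ∷ r) {suc c} {suc w} (s≤s c<w) = head-drop-take r c<w

  nonzeroAt-drop : (r : Row k) (a c : ℕ) → nonzeroAt (drop a r) c ≡ nonzeroAt r (a + c)
  nonzeroAt-drop r a c = trans (nonzeroAt≡nonzeroHead (drop a r) c)
    (trans (cong (nonzeroHead ∘ head) (drop-drop a c r)) (sym (nonzeroAt≡nonzeroHead r (a + c))))

  nonzeroAt⇒nonzeroRow : (r : Row k) (c : ℕ) → nonzeroAt r c ≡ true → nonzeroRow r ≡ true
  nonzeroAt⇒nonzeroRow r c e =
    nonzeroRow-drop⇒ c r (nonzeroHead⇒ (drop c r) (trans (sym (nonzeroAt≡nonzeroHead r c)) e))
    where
    nonzeroHead⇒ : (s : Row k) → nonzeroHead (head s) ≡ true → nonzeroRow s ≡ true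
    nonzeroHead⇒ (x ∷ s) e = cong (_∨ nonzeroRow s) e

  nonzeroCol-filterᵇ : (Y : Mat k) (c : ℕ) → nonzeroCol (filterᵇ nonzeroRow Y) c ≡ nonzeroCol Y c
  nonzeroCol-filterᵇ []      c = refl
  nonzeroCol-filterᵇ (y ∷ Y) c rewrite filterᵇ-∷ nonzeroRow y Y with nonzeroRow y in y≢0
  ... | true  = cong (nonzeroAt y c ∨_) (nonzeroCol-filterᵇ Y c)
  ... | false = trans (nonzeroCol-filterᵇ Y c) (cong (_∨ nonzeroCol Y c) (sym y[c]≡0))
    where
    y[c]≡0 : nonzeroAt y c ≡ false
    y[c]≡0 = ¬-not (λ e → case trans (sym y≢0) (nonzeroAt⇒nonzeroRow y c e) of λ ())

  nonzeroCol-map : (f : Row k → Row k) (c c′ : ℕ) → (∀ r → nonzeroAt (f r) c ≡ nonzeroAt r c′) →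
    (Y : Mat k) → nonzeroCol (map f Y) c ≡ nonzeroCol Y c′
  nonzeroCol-map f c c′ f-at []      = refl
  nonzeroCol-map f c c′ f-at (y ∷ Y) = cong₂ _∨_ (f-at y) (nonzeroCol-map f c c′ f-at Y)

  RowLengths : Mat k → ℕ → Set
  RowLengths Y w = All (λ r → length r ≡ w) Y

  NonzeroColumns : Mat k → ℕ → Set
  NonzeroColumns Y w = ∀ c → c < w → nonzeroCol Y c ≡ true

  RowLengths-take : {Y : Mat k} {w : ℕ} (i : ℕ) → i ≤ w → RowLengths Y w → RowLengths (leftCols i Y) i
  RowLengths-take i i≤w []         = []
  RowLengths-take i i≤w (e ∷ es) = trans (length-take i _) (trans (cong (i ⊓_) e) (m≤n⇒m⊓n≡m i≤w)) ∷ RowLengths-take i i≤w es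

  RowLengths-drop : {Y : Mat k} {w : ℕ} (i : ℕ) → RowLengths Y w → RowLengths (rightCols i Y) (w ∸ i)
  RowLengths-drop i []         = []
  RowLengths-drop i (e ∷ es) = trans (length-drop i _) (cong (_∸ i) e) ∷ RowLengths-drop i es

  NonzeroColumns-take : (Y : Mat k) {w : ℕ} (i : ℕ) → i ≤ w → NonzeroColumns Y w → NonzeroColumns (leftCols i Y) i
  NonzeroColumns-take Y i i≤w cols c c<i =
    trans (nonzeroCol-map (take i) c c (λ r → nonzeroAt-take r c<i) Y) (cols c (≤-trans c<i i≤w))

  NonzeroColumns-drop : (Y : Mat k) {w : ℕ} (i : ℕ) → NonzeroColumns Y w → NonzeroColumns (rightCols i Y) (w ∸ i)
  NonzeroColumns-drop Y {w} i cols c c<w∸i =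
    trans (nonzeroCol-map (drop i) c (i + c) (λ r → nonzeroAt-drop r i c) Y) (cols (i + c) i+c<w)
    where
    i+c<w : i + c < w
    i+c<w with i ≤? w
    ... | yes i≤w = subst (i + c <_) (m+[n∸m]≡n i≤w) (+-monoʳ-< i c<w∸i)
    ... | no  i≰w = ⊥-elim (n≮0 (subst (c <_) (m≤n⇒m∸n≡0 (≰⇒≥ i≰w)) c<w∸i))

  NonzeroColumns-filterᵇ : (Y : Mat k) {w : ℕ} → NonzeroColumns Y w → NonzeroColumns (filterᵇ nonzeroRow Y) w
  NonzeroColumns-filterᵇ Y cols c c<w = trans (nonzeroCol-filterᵇ Y c) (cols c c<w)

  cp≡filterᵇ : {Y : Mat k} {w : ℕ} → RowLengths Y w → NonzeroColumns Y w → cp Y ≡ filterᵇ nonzeroRow Y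
  cp≡filterᵇ {Y} {w} lens cols = map-id-local (keepsAll (filterᵇ nonzeroRow Y) (All.filter⁺ (T? ∘ nonzeroRow) lens))
    where
    keepsAll : (Z : Mat k) → RowLengths Z w →
      All (λ r → map proj₂ (filterᵇ (nonzeroCol Y ∘ proj₁) (zip (upTo (length r)) r)) ≡ r) Z
    keepsAll []      []         = []
    keepsAll (r ∷ Z) (e ∷ es) = map-proj₂-filterᵇ-zip (nonzeroCol Y) (upTo (length r)) r
      (subst (All _) (sym (upTo≡range (length r)))
        (All.map (λ {c} (_ , c<) → cols c (subst (c <_) e c<)) (range-bounds 0 (length r))))
      (≤-reflexive (sym (length-upTo (length r)))) ∷ keepsAll Z es

  isSquare-filterᵇ : {Y : Mat k} {w : ℕ} → RowLengths Y w → NonzeroColumns Y w →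
    isSquare (filterᵇ nonzeroRow Y) ≡ (length (filterᵇ nonzeroRow Y) ≡ᵇ w)
  isSquare-filterᵇ {Y} {w} lens cols = cong (length (filterᵇ nonzeroRow Y) ≡ᵇ_) (width≡ (filterᵇ nonzeroRow Y) w
    (All.filter⁺ (T? ∘ nonzeroRow) lens) (NonzeroColumns-filterᵇ Y cols))
    where
    width≡ : (Z : Mat k) (w : ℕ) → RowLengths Z w → NonzeroColumns Z w → width Z ≡ w
    width≡ (_ ∷ _) w (e ∷ _) _    = e
    width≡ []      zero    _ _    = refl
    width≡ []      (suc w) _ cols = case cols 0 z<s of λ ()

  filterᵇ-map-filterᵇ : (f : Row k → Row k) → (∀ r → nonzeroRow (f r) ≡ true → nonzeroRow r ≡ true) →
    (Y : Mat k) → filterᵇ nonzeroRow (map f (filterᵇ nonzeroRow Y)) ≡ filterᵇ nonzeroRow (map f Y)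
  filterᵇ-map-filterᵇ f f-reflects [] = refl
  filterᵇ-map-filterᵇ f f-reflects (y ∷ Y) rewrite filterᵇ-∷ nonzeroRow y Y with nonzeroRow y in y≢0
  ... | true = trans (filterᵇ-∷ nonzeroRow (f y) _)
    (trans (cong (λ Z → if nonzeroRow (f y) then f y ∷ Z else Z) (filterᵇ-map-filterᵇ f f-reflects Y))
           (sym (filterᵇ-∷ nonzeroRow (f y) _)))
  ... | false with nonzeroRow (f y) in fy≢0
  ...   | false = filterᵇ-map-filterᵇ f f-reflects Y
  ...   | true  = case trans (sym y≢0) (f-reflects y fy≢0) of λ ()

  filterᵇ-nonzeroRow-empties : (X : Mat k) → filterᵇ (nonzeroRow {k}) (map (λ _ → []) X) ≡ []
  filterᵇ-nonzeroRow-empties []      = refl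
  filterᵇ-nonzeroRow-empties (_ ∷ X) = filterᵇ-nonzeroRow-empties X

  lastRow≡fromMaybe : (N : Mat k) → lastRow N ≡ Maybe.fromMaybe [] (last N)
  lastRow≡fromMaybe N with last N
  ... | just _  = refl
  ... | nothing = refl

  lastRow-map : (f : Row k → Row k) → f [] ≡ [] → (N : Mat k) → lastRow (map f N) ≡ f (lastRow N)
  lastRow-map f f[]≡[] N rewrite lastRow≡fromMaybe (map f N) | lastRow≡fromMaybe N | last-map f N with last N
  ... | just _  = refl
  ... | nothing = sym f[]≡[]

  lastRow-filterᵇ : (N : Mat k) → nonzeroRow (lastRow N) ≡ true → lastRow (filterᵇ nonzeroRow N) ≡ lastRow N
  lastRow-filterᵇ N ℓ≢0 rewrite lastRow≡fromMaybe (filterᵇ nonzeroRow N) | lastRow≡fromMaybe N with last N in eq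
  ... | just r  rewrite last-filterᵇ nonzeroRow N eq ℓ≢0 = refl

  lastRow-block : (f : Row k → Row k) → f [] ≡ [] → (X : Mat k) → nonzeroRow (f (lastRow X)) ≡ true →
    lastRow (filterᵇ nonzeroRow (map f X)) ≡ f (lastRow X)
  lastRow-block f f[]≡[] X fℓ≢0 =
    trans (lastRow-filterᵇ (map f X) (trans (cong nonzeroRow (lastRow-map f f[]≡[] X)) fℓ≢0)) (lastRow-map f f[]≡[] X)

  All-lastRow : {P : Row k → Set} {N : Mat k} → All P N → N ≢ [] → P (lastRow N)
  All-lastRow {P} {N} all N≢[] rewrite lastRow≡fromMaybe N = go all N≢[]
    where
    go : {N : Mat k} → All P N → N ≢ [] → P (Maybe.fromMaybe [] (last N))
    go []                  N≢[] = ⊥-elim (N≢[] refl)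
    go (p ∷ [])            _    = p
    go (_ ∷ ps@(_ ∷ _))    _    = go ps (λ ())

module _ {k : ℕ} where

  record WellFormed (X : Mat k) (w : ℕ) : Set where
    field
      rowLengths     : RowLengths X w
      nonzeroColumns : NonzeroColumns X w
      nonzeroRows    : All (λ r → nonzeroRow r ≡ true) X
  open WellFormed public

  Packed⇒WellFormed : {M : Mat k} → Packed k M → WellFormed M (length M)
  Packed⇒WellFormed {M} packed = record
    { rowLengths     = All.map (≡ᵇ≡true⇒ _ _) (all≡true⇒ (Packed.rowsLength packed))
    ; nonzeroColumns = λ c c<n → All.lookup (all≡true⇒ (Packed.colsNZ packed)) (∈-upTo⁺ c<n)
    ; nonzeroRows    = all≡true⇒ (Packed.rowsNZ packed)
    }

  leftBlock : ℕ → Mat k → Mat k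
  leftBlock i X = filterᵇ nonzeroRow (leftCols i X)

  rightBlock : ℕ → Mat k → Mat k
  rightBlock i X = filterᵇ nonzeroRow (rightCols i X)

  middleBlock : ℕ → ℕ → Mat k → Mat k
  middleBlock i j X = filterᵇ nonzeroRow (leftCols (j ∸ i) (rightCols i X))

  private
    block-of-block : (f g h : Row k → Row k) → (∀ r → nonzeroRow (f r) ≡ true → nonzeroRow r ≡ true) →
      (∀ r → f (g r) ≡ h r) → (X : Mat k) →
      filterᵇ nonzeroRow (map f (filterᵇ nonzeroRow (map g X))) ≡ filterᵇ nonzeroRow (map h X)
    block-of-block f g h f-reflects fg≗h X =
      trans (filterᵇ-map-filterᵇ f f-reflects (map g X)) (cong (filterᵇ nonzeroRow) (trans (sym (map-∘ X)) (map-cong fg≗h X)))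

  leftBlock-leftBlock : {i j : ℕ} → i ≤ j → (X : Mat k) → leftBlock i (leftBlock j X) ≡ leftBlock i X
  leftBlock-leftBlock {i} {j} i≤j = block-of-block (take i) (take j) (take i) (nonzeroRow-take⇒ i)
    (take-take-≤ i≤j)

  rightBlock-leftBlock : {i j : ℕ} → i ≤ j → (X : Mat k) → rightBlock i (leftBlock j X) ≡ middleBlock i j X
  rightBlock-leftBlock {i} {j} i≤j X = trans (block-of-block (drop i) (take j) (take (j ∸ i) ∘ drop i) (nonzeroRow-drop⇒ i)
    (drop-take-≤ i≤j) X)
    (cong (filterᵇ nonzeroRow) (map-∘ X))

  leftBlock-rightBlock : (i j : ℕ) (X : Mat k) → leftBlock (j ∸ i) (rightBlock i X) ≡ middleBlock i j X
  leftBlock-rightBlock i j X = filterᵇ-map-filterᵇ (take (j ∸ i)) (nonzeroRow-take⇒ (j ∸ i)) (rightCols i X)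

  rightBlock-rightBlock : {i j : ℕ} → i ≤ j → (X : Mat k) → rightBlock (j ∸ i) (rightBlock i X) ≡ rightBlock j X
  rightBlock-rightBlock {i} {j} i≤j = block-of-block (drop (j ∸ i)) (drop i) (drop j) (nonzeroRow-drop⇒ (j ∸ i))
    (drop-drop-≤ i≤j)

  isSquare-block : {Y : Mat k} {w : ℕ} → RowLengths Y w → NonzeroColumns Y w →
    isSquare (filterᵇ nonzeroRow Y) ≡ (count nonzeroRow Y ≡ᵇ w)
  isSquare-block {Y} lens cols = trans (isSquare-filterᵇ lens cols) (cong (_≡ᵇ _) (length-filterᵇ nonzeroRow Y))

  module Blocks {X : Mat k} {w : ℕ} (wf : WellFormed X w) where

    private
      lens-left : {i : ℕ} → i ≤ w → RowLengths (leftCols i X) i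
      lens-left {i} i≤w = RowLengths-take i i≤w (rowLengths wf)

      cols-left : {i : ℕ} → i ≤ w → NonzeroColumns (leftCols i X) i
      cols-left {i} i≤w = NonzeroColumns-take X i i≤w (nonzeroColumns wf)

      lens-right : (i : ℕ) → RowLengths (rightCols i X) (w ∸ i)
      lens-right i = RowLengths-drop i (rowLengths wf)

      cols-right : (i : ℕ) → NonzeroColumns (rightCols i X) (w ∸ i)
      cols-right i = NonzeroColumns-drop X i (nonzeroColumns wf)

    cpPair≡ : {i : ℕ} → i ≤ w → cpPair X i ≡ (leftBlock i X , rightBlock i X)
    cpPair≡ {i} i≤w = cong₂ _,_ (cp≡filterᵇ (lens-left i≤w) (cols-left i≤w)) (cp≡filterᵇ (lens-right i) (cols-right i))

    isColDec≡ : {i : ℕ} → i ≤ w → isColDec X i ≡ isSquare (leftBlock i X) ∧ isSquare (rightBlock i X)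
    isColDec≡ i≤w = cong (λ p → isSquare (proj₁ p) ∧ isSquare (proj₂ p)) (cpPair≡ i≤w)

    wf-leftBlock : {i : ℕ} → i ≤ w → WellFormed (leftBlock i X) i
    wf-leftBlock {i} i≤w = record
      { rowLengths     = All.filter⁺ (T? ∘ nonzeroRow) (lens-left i≤w)
      ; nonzeroColumns = NonzeroColumns-filterᵇ (leftCols i X) (cols-left i≤w)
      ; nonzeroRows    = All.map T⇒≡true (All.all-filter (T? ∘ nonzeroRow) (leftCols i X))
      }

    wf-rightBlock : (i : ℕ) → WellFormed (rightBlock i X) (w ∸ i)
    wf-rightBlock i = record
      { rowLengths     = All.filter⁺ (T? ∘ nonzeroRow) (lens-right i)
      ; nonzeroColumns = NonzeroColumns-filterᵇ (rightCols i X) (cols-right i)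
      ; nonzeroRows    = All.map T⇒≡true (All.all-filter (T? ∘ nonzeroRow) (rightCols i X))
      }

    isSquare-leftBlock : {i : ℕ} → i ≤ w → isSquare (leftBlock i X) ≡ (count (nonzeroRow ∘ take i) X ≡ᵇ i)
    isSquare-leftBlock {i} i≤w = trans (isSquare-block (lens-left i≤w) (cols-left i≤w)) (cong (_≡ᵇ i) (count-map nonzeroRow (take i) X))

    isSquare-rightBlock : (i : ℕ) → isSquare (rightBlock i X) ≡ (count (nonzeroRow ∘ drop i) X ≡ᵇ (w ∸ i))
    isSquare-rightBlock i = trans (isSquare-block (lens-right i) (cols-right i)) (cong (_≡ᵇ (w ∸ i)) (count-map nonzeroRow (drop i) X))

    isSquare-middleBlock : {i j : ℕ} → j ≤ w →
      isSquare (middleBlock i j X) ≡ (count (nonzeroRow ∘ take (j ∸ i) ∘ drop i) X ≡ᵇ (j ∸ i))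
    isSquare-middleBlock {i} {j} j≤w =
      trans (isSquare-block (RowLengths-take (j ∸ i) j∸i≤w∸i (lens-right i)) (NonzeroColumns-take (rightCols i X) (j ∸ i) j∸i≤w∸i (cols-right i)))
            (cong (_≡ᵇ (j ∸ i)) (trans (count-map nonzeroRow (take (j ∸ i)) (rightCols i X)) (count-map (nonzeroRow ∘ take (j ∸ i)) (drop i) X)))
      where
      j∸i≤w∸i : j ∸ i ≤ w ∸ i
      j∸i≤w∸i = ∸-monoˡ-≤ i j≤w

    length-leftBlock : {i : ℕ} → i ≤ w → isSquare (leftBlock i X) ≡ true → length (leftBlock i X) ≡ i
    length-leftBlock i≤w sq = ≡ᵇ≡true⇒ _ _ (trans (sym (isSquare-filterᵇ (lens-left i≤w) (cols-left i≤w))) sq)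

    length-rightBlock : (i : ℕ) → isSquare (rightBlock i X) ≡ true → length (rightBlock i X) ≡ w ∸ i
    length-rightBlock i sq = ≡ᵇ≡true⇒ _ _ (trans (sym (isSquare-filterᵇ (lens-right i) (cols-right i))) sq)

    count-leftBlock : {i : ℕ} → i ≤ w → isSquare (leftBlock i X) ≡ true → count (nonzeroRow ∘ take i) X ≡ i
    count-leftBlock {i} i≤w sq = ≡ᵇ≡true⇒ _ i (trans (sym (isSquare-leftBlock i≤w)) sq)

    count-rightBlock : (i : ℕ) → isSquare (rightBlock i X) ≡ true → count (nonzeroRow ∘ drop i) X ≡ w ∸ i
    count-rightBlock i sq = ≡ᵇ≡true⇒ _ (w ∸ i) (trans (sym (isSquare-rightBlock i)) sq)

    count-middleBlock : {i j : ℕ} → j ≤ w → isSquare (middleBlock i j X) ≡ true →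
      count (nonzeroRow ∘ take (j ∸ i) ∘ drop i) X ≡ j ∸ i
    count-middleBlock {i} {j} j≤w sq = ≡ᵇ≡true⇒ _ (j ∸ i) (trans (sym (isSquare-middleBlock {i} j≤w)) sq)

  module _ {X : Mat k} {w : ℕ} (wf : WellFormed X w) where
    open Blocks wf

    cpPair-leftBlock : {i j : ℕ} → i ≤ j → j ≤ w → cpPair (leftBlock j X) i ≡ (leftBlock i X , middleBlock i j X)
    cpPair-leftBlock {i} {j} i≤j j≤w = trans (Blocks.cpPair≡ (wf-leftBlock j≤w) i≤j)
      (cong₂ _,_ (leftBlock-leftBlock i≤j X) (rightBlock-leftBlock i≤j X))

    cpPair-rightBlock : {i j : ℕ} → i ≤ j → j ≤ w → cpPair (rightBlock i X) (j ∸ i) ≡ (middleBlock i j X , rightBlock j X)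
    cpPair-rightBlock {i} {j} i≤j j≤w = trans (Blocks.cpPair≡ (wf-rightBlock i) (∸-monoˡ-≤ i j≤w))
      (cong₂ _,_ (leftBlock-rightBlock i j X) (rightBlock-rightBlock i≤j X))

-- Coproducts with a condition on the last row

SplitCondition : ℕ → Set
SplitCondition k = Row k → ℕ → Bool

module _ {k : ℕ} where

  Δ[_] : SplitCondition k → Mat k → Tensor2 k
  Δ[ c ] X = map (cpPair X) (filterᵇ (λ i → isColDec X i ∧ c (lastRow X) i) (innerSplits X))

  lastInLeft lastInRight lastAnywhere : SplitCondition k
  lastInLeft   r i = zeroRow (drop i r)
  lastInRight  r i = zeroRow (take i r)
  lastAnywhere _ _ = true

  Δ≺≡Δ[lastInLeft] : (X : Mat k) → Δ≺ X ≡ Δ[ lastInLeft ] X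
  Δ≺≡Δ[lastInLeft] X = cong (map (cpPair X)) (filterᵇ-cong
    (λ i → cong (λ r → isColDec X i ∧ zeroRow r) (lastRow-map (drop i) (drop-[] i) X)) (innerSplits X))

  Δ≻≡Δ[lastInRight] : (X : Mat k) → Δ≻ X ≡ Δ[ lastInRight ] X
  Δ≻≡Δ[lastInRight] X = cong (map (cpPair X)) (filterᵇ-cong
    (λ i → cong (λ r → isColDec X i ∧ zeroRow r) (lastRow-map (take i) (take-[] i) X)) (innerSplits X))

  ⊗I-cong : {f g : Mat k → Tensor2 k} → (∀ X → f X ≡ g X) → (t : Tensor2 k) → (f ⊗I) t ≡ (g ⊗I) t
  ⊗I-cong f≗g = concatMap-cong (λ p → cong (map _) (f≗g (proj₁ p)))

  I⊗-cong : {f g : Mat k → Tensor2 k} → (∀ X → f X ≡ g X) → (t : Tensor2 k) → (I⊗ f) t ≡ (I⊗ g) t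
  I⊗-cong f≗g = concatMap-cong (λ p → cong (map _) (f≗g (proj₂ p)))

  innerSplits≡range : (X : Mat k) → innerSplits X ≡ range 1 (length X ∸ 1)
  innerSplits≡range X = trans (cong (map suc) (upTo≡range _)) (map-+-range 1 0 _)

  -- Counting nonzero rows: #(a ∧ b) = #a + #b − #(a ∨ b) = i + (w ∸ i) − w = 0.
  isColDec⇒disjoint : {X : Mat k} {w : ℕ} → WellFormed X w → length X ≡ w → {i : ℕ} → i ≤ w → isColDec X i ≡ true →
    All (λ r → (nonzeroRow (take i r) ∧ nonzeroRow (drop i r)) ≡ false) X
  isColDec⇒disjoint {X} {w} wf len {i} i≤w dec = count≡0⇒ _ X count∧≡0
    where
    open Blocks wf
    a b : Row k → Bool
    a = nonzeroRow ∘ take i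
    b = nonzeroRow ∘ drop i
    squares : (isSquare (leftBlock i X) ≡ true) × (isSquare (rightBlock i X) ≡ true)
    squares = ∧≡true⇒ (trans (sym (isColDec≡ i≤w)) dec)
    count∨≡w : count (λ r → a r ∨ b r) X ≡ w
    count∨≡w = trans (count-cong (λ r → sym (nonzeroRow-take-drop i r)) X) (trans (count-all (nonzeroRows wf)) len)
    count∧≡0 : count (λ r → a r ∧ b r) X ≡ 0
    count∧≡0 = +-cancelˡ-≡ w _ 0 (begin
      w + count (λ r → a r ∧ b r) X                        ≡⟨ cong (_+ count (λ r → a r ∧ b r) X) count∨≡w ⟨
      count (λ r → a r ∨ b r) X + count (λ r → a r ∧ b r) X ≡⟨ count-∨+count-∧ a b X ⟩
      count a X + count b X                                 ≡⟨ cong₂ _+_ (count-leftBlock i≤w (proj₁ squares)) (count-rightBlock i (proj₂ squares)) ⟩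
      i + (w ∸ i)                                           ≡⟨ trans (m+[n∸m]≡n i≤w) (sym (+-identityʳ w)) ⟩
      w + 0                                                 ∎)
      where open ≡-Reasoning

  Δ̄↭Δ[lastAnywhere] : {X : Mat k} {w : ℕ} → WellFormed X w → length X ≡ w → Δ̄ X ↭ Δ[ lastAnywhere ] X
  Δ̄↭Δ[lastAnywhere] {X} {w} wf len =
    ↭-trans (↭-reflexive (sym (map-++ (cpPair X) (filterᵇ (λ i → isColDec X i ∧ inLeft i) (innerSplits X)) _)))
            (map⁺ (cpPair X) (filterᵇ-∧-partition (isColDec X) inLeft inRight (innerSplits X) one-side))
    where
    inLeft inRight : ℕ → Bool
    inLeft  i = zeroRow (lastRow (rightCols i X))
    inRight i = zeroRow (lastRow (leftCols i X))

    one-side-at : ∀ {i} → 1 ≤ i → i < 1 + (length X ∸ 1) → isColDec X i ≡ true → inRight i ≡ not (inLeft i)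
    one-side-at {i} 1≤i i< dec rewrite lastRow-map (take i) (take-[] i) X | lastRow-map (drop i) (drop-[] i) X =
      cong not (∨≡true-∧≡false⇒ cover disjoint)
      where
      X≢[] : X ≢ []
      X≢[] refl = <⇒≱ i< 1≤i
      i≤w : i ≤ w
      i≤w = subst (i ≤_) len (<⇒≤ (<1+[n∸1]⇒< 1≤i i<))
      disjoint : (nonzeroRow (take i (lastRow X)) ∧ nonzeroRow (drop i (lastRow X))) ≡ false
      disjoint = All-lastRow (isColDec⇒disjoint wf len i≤w dec) X≢[]
      cover : (nonzeroRow (take i (lastRow X)) ∨ nonzeroRow (drop i (lastRow X))) ≡ true
      cover = trans (sym (nonzeroRow-take-drop i (lastRow X))) (All-lastRow (nonzeroRows wf) X≢[])

    one-side : All (λ i → isColDec X i ≡ true → inRight i ≡ not (inLeft i)) (innerSplits X)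
    one-side = subst (All _) (sym (innerSplits≡range X))
      (All.map (λ (1≤i , i<) → one-side-at 1≤i i<) (range-bounds 1 (length X ∸ 1)))

  splitGuard : SplitCondition k → Mat k → (s w : ℕ) → ℕ → Bool
  splitGuard c X s w j = inRange (s + 1) (w ∸ 1) j ∧ (isColDec X (j ∸ s) ∧ c (lastRow X) (j ∸ s))

  splitGuard⇒ : ∀ {c X s w j} → splitGuard c X s w j ≡ true → s < j × j < s + w
  splitGuard⇒ {s = s} {w} g = inRange-suc⇒ {s} {w} (proj₁ (∧≡true⇒ g))

  -- Reindexing by j = s + i puts the splits of the blocks of a matrix on one common range [0, N).
  concatMap-Δ[c] : (c : SplitCondition k) (h : Mat k × Mat k → List A) {X : Mat k} {w : ℕ} (s N : ℕ) →
    length X ≡ w → 1 ≤ w → s + w ≤ N →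
    concatMap h (Δ[ c ] X) ≡ concatMap (λ j → when (splitGuard c X s w j) (h (cpPair X (j ∸ s)))) (range 0 N)
  concatMap-Δ[c] c h {X} {w} s N len 1≤w s+w≤N = begin
    concatMap h (map (cpPair X) (filterᵇ D (innerSplits X)))
      ≡⟨ concatMap-map h (cpPair X) (filterᵇ D (innerSplits X)) ⟩
    concatMap (h ∘ cpPair X) (filterᵇ D (innerSplits X))
      ≡⟨ concatMap-filterᵇ (h ∘ cpPair X) D (innerSplits X) ⟩
    concatMap F (innerSplits X)
      ≡⟨ cong (concatMap F) (trans (innerSplits≡range X) (cong (λ m → range 1 (m ∸ 1)) len)) ⟩
    concatMap F (range 1 (w ∸ 1))
      ≡⟨ concatMap-shift F s 1 (w ∸ 1) ⟨
    concatMap (λ j → F (j ∸ s)) (range (s + 1) (w ∸ 1))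
      ≡⟨ concatMap-subrange (λ j → F (j ∸ s)) (s + 1) (w ∸ 1) N bound ⟩
    concatMap (λ j → when (inRange (s + 1) (w ∸ 1) j) (F (j ∸ s))) (range 0 N)
      ≡⟨ concatMap-cong (λ j → when-when (inRange (s + 1) (w ∸ 1) j) (D (j ∸ s)) (h (cpPair X (j ∸ s)))) (range 0 N) ⟩
    concatMap (λ j → when (splitGuard c X s w j) (h (cpPair X (j ∸ s)))) (range 0 N) ∎
    where
    open ≡-Reasoning
    D : ℕ → Bool
    D i = isColDec X i ∧ c (lastRow X) i
    F : ℕ → List _
    F i = when (D i) (h (cpPair X i))
    bound : s + 1 + (w ∸ 1) ≤ N
    bound = subst (_≤ N) (sym (trans (+-assoc s 1 (w ∸ 1)) (cong (s +_) (m+[n∸m]≡n 1≤w)))) s+w≤N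

module _ {k : ℕ} where

  module ThreeBlocks {X : Mat k} {n : ℕ} (wf : WellFormed X n) (len : length X ≡ n) {i j : ℕ} (i≤j : i ≤ j) (j≤n : j ≤ n) where
    open Blocks wf

    private
      a b c : Row k → Bool
      a = nonzeroRow ∘ take i
      b = nonzeroRow ∘ take (j ∸ i) ∘ drop i
      c = nonzeroRow ∘ drop j

      #a : isSquare (leftBlock i X) ≡ true → count a X ≡ i
      #a = count-leftBlock (≤-trans i≤j j≤n)

      #b : isSquare (middleBlock i j X) ≡ true → count b X ≡ j ∸ i
      #b = count-middleBlock {i} j≤n

      #c : isSquare (rightBlock j X) ≡ true → count c X ≡ n ∸ j
      #c = count-rightBlock j

      #a∨b∨c : count (λ r → a r ∨ (b r ∨ c r)) X ≡ n
      #a∨b∨c = trans (count-cong (λ r → sym (trans (nonzeroRow-take-drop i r) (cong (a r ∨_) (nonzeroRow-drop-split i≤j r)))) X)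
                     (trans (count-all (nonzeroRows wf)) len)

      [j∸i]+[n∸j]≡n∸i : (j ∸ i) + (n ∸ j) ≡ n ∸ i
      [j∸i]+[n∸j]≡n∸i = sym (trans (cong (_∸ i) (sym i+[j∸i]+[n∸j]≡n)) (m+n∸m≡n i _))
        where
        i+[j∸i]+[n∸j]≡n : i + ((j ∸ i) + (n ∸ j)) ≡ n
        i+[j∸i]+[n∸j]≡n = trans (sym (+-assoc i _ _)) (trans (cong (_+ (n ∸ j)) (m+[n∸m]≡n i≤j)) (m+[n∸m]≡n j≤n))

    -- #(a ∨ b) ≤ #a + #b = j, while n = #(a ∨ b ∨ c) ≤ #(a ∨ b) + #c = #(a ∨ b) + (n ∸ j); likewise for b ∨ c.
    squares-compose : isSquare (leftBlock i X) ≡ true → isSquare (middleBlock i j X) ≡ true → isSquare (rightBlock j X) ≡ true →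
      (isSquare (leftBlock j X) ≡ true) × (isSquare (rightBlock i X) ≡ true)
    squares-compose sqA sqB sqC =
      trans (isSquare-leftBlock j≤n) (≡⇒≡ᵇ≡true (trans (count-cong (nonzeroRow-take-split i≤j) X) #a∨b≡j)) ,
      trans (isSquare-rightBlock i) (≡⇒≡ᵇ≡true (trans (count-cong (nonzeroRow-drop-split i≤j) X) #b∨c≡n∸i))
      where
      open ≤-Reasoning
      #a∨b≡j : count (λ r → a r ∨ b r) X ≡ j
      #a∨b≡j = ≤-antisym
        (begin
          count (λ r → a r ∨ b r) X ≤⟨ count-∨-≤ a b X ⟩
          count a X + count b X     ≡⟨ cong₂ _+_ (#a sqA) (#b sqB) ⟩
          i + (j ∸ i)               ≡⟨ m+[n∸m]≡n i≤j ⟩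
          j                         ∎)
        (+-cancelʳ-≤ (n ∸ j) j _ (begin
          j + (n ∸ j)                               ≡⟨ m+[n∸m]≡n j≤n ⟩
          n                                         ≡⟨ #a∨b∨c ⟨
          count (λ r → a r ∨ (b r ∨ c r)) X         ≡⟨ count-cong (λ r → sym (∨-assoc (a r) (b r) (c r))) X ⟩
          count (λ r → (a r ∨ b r) ∨ c r) X         ≤⟨ count-∨-≤ (λ r → a r ∨ b r) c X ⟩
          count (λ r → a r ∨ b r) X + count c X     ≡⟨ cong (count (λ r → a r ∨ b r) X +_) (#c sqC) ⟩
          count (λ r → a r ∨ b r) X + (n ∸ j)       ∎))
      #b∨c≡n∸i : count (λ r → b r ∨ c r) X ≡ n ∸ i
      #b∨c≡n∸i = ≤-antisym
        (begin
          count (λ r → b r ∨ c r) X ≤⟨ count-∨-≤ b c X ⟩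
          count b X + count c X     ≡⟨ cong₂ _+_ (#b sqB) (#c sqC) ⟩
          (j ∸ i) + (n ∸ j)         ≡⟨ [j∸i]+[n∸j]≡n∸i ⟩
          n ∸ i                     ∎)
        (+-cancelˡ-≤ i (n ∸ i) _ (begin
          i + (n ∸ i)                           ≡⟨ m+[n∸m]≡n (≤-trans i≤j j≤n) ⟩
          n                                     ≡⟨ #a∨b∨c ⟨
          count (λ r → a r ∨ (b r ∨ c r)) X     ≤⟨ count-∨-≤ a (λ r → b r ∨ c r) X ⟩
          count a X + count (λ r → b r ∨ c r) X ≡⟨ cong (_+ count (λ r → b r ∨ c r) X) (#a sqA) ⟩
          i + count (λ r → b r ∨ c r) X         ∎))

    isColDec-assoc : (isColDec X j ∧ isColDec (leftBlock j X) i) ≡ (isColDec X i ∧ isColDec (rightBlock i X) (j ∸ i))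
    isColDec-assoc = begin
      isColDec X j ∧ isColDec (leftBlock j X) i
        ≡⟨ cong₂ _∧_ (isColDec≡ j≤n) (cong bothSquare (cpPair-leftBlock wf i≤j j≤n)) ⟩
      (isSquare (leftBlock j X) ∧ isSquare (rightBlock j X)) ∧ (isSquare (leftBlock i X) ∧ isSquare (middleBlock i j X))
        ≡⟨ ∧-assoc-squares squares-compose ⟩
      (isSquare (leftBlock i X) ∧ isSquare (rightBlock i X)) ∧ (isSquare (middleBlock i j X) ∧ isSquare (rightBlock j X))
        ≡⟨ cong₂ _∧_ (isColDec≡ (≤-trans i≤j j≤n)) (cong bothSquare (cpPair-rightBlock wf i≤j j≤n)) ⟨
      isColDec X i ∧ isColDec (rightBlock i X) (j ∸ i) ∎
      where
      open ≡-Reasoning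
      bothSquare : Mat k × Mat k → Bool
      bothSquare p = isSquare (proj₁ p) ∧ isSquare (proj₂ p)

  module LastRowConditions {X : Mat k} (ℓ≢0 : nonzeroRow (lastRow X) ≡ true) {i j : ℕ} (i≤j : i ≤ j) where

    private
      ℓ : Row k
      ℓ = lastRow X

      a b c : Bool
      a = nonzeroRow (take i ℓ)
      b = nonzeroRow (take (j ∸ i) (drop i ℓ))
      c = nonzeroRow (drop j ℓ)

      cover : (a ∨ (b ∨ c)) ≡ true
      cover = trans (sym (trans (nonzeroRow-take-drop i ℓ) (cong (a ∨_) (nonzeroRow-drop-split i≤j ℓ)))) ℓ≢0

      lastRow-leftBlock : (a ∨ b) ≡ true → lastRow (leftBlock j X) ≡ take j ℓ
      lastRow-leftBlock a∨b = lastRow-block (take j) (take-[] j) X (trans (nonzeroRow-take-split i≤j ℓ) a∨b)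

      lastRow-rightBlock : (b ∨ c) ≡ true → lastRow (rightBlock i X) ≡ drop i ℓ
      lastRow-rightBlock b∨c = lastRow-block (drop i) (drop-[] i) X (trans (nonzeroRow-drop-split i≤j ℓ) b∨c)

    lastRow-codendriform₁ : (lastInLeft ℓ j ∧ lastInLeft (lastRow (leftBlock j X)) i)
                          ≡ (lastInLeft ℓ i ∧ lastAnywhere (lastRow (rightBlock i X)) (j ∸ i))
    lastRow-codendriform₁ = trans
      (bool-identity {a} {b} {c} cover (λ a∨b → trans (cong (λ r → zeroRow (drop i r)) (lastRow-leftBlock a∨b)) (cong (not ∘ nonzeroRow) (drop-take-≤ i≤j ℓ))))
      (cong (λ u → not u ∧ true) (sym (nonzeroRow-drop-split i≤j ℓ)))
      where
      bool-identity : ∀ {a b c x} → (a ∨ (b ∨ c)) ≡ true → ((a ∨ b) ≡ true → x ≡ not b) → (not c ∧ x) ≡ (not (b ∨ c) ∧ true)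
      bool-identity {_}     {true}  {true}  _ _  = refl
      bool-identity {_}     {false} {true}  _ _  = refl
      bool-identity {true}  {b}     {false} _ x≡ rewrite x≡ refl with b
      ... | true  = refl
      ... | false = refl
      bool-identity {false} {true}  {false} _ x≡ rewrite x≡ refl = refl

    lastRow-codendriform₂ : (lastInLeft ℓ j ∧ lastInRight (lastRow (leftBlock j X)) i)
                          ≡ (lastInRight ℓ i ∧ lastInLeft (lastRow (rightBlock i X)) (j ∸ i))
    lastRow-codendriform₂ = bool-identity {a} {b} {c} cover
      (λ a∨b → trans (cong (λ r → zeroRow (take i r)) (lastRow-leftBlock a∨b)) (cong (not ∘ nonzeroRow) (take-take-≤ i≤j ℓ)))
      (λ b∨c → trans (cong (λ r → zeroRow (drop (j ∸ i) r)) (lastRow-rightBlock b∨c)) (cong (not ∘ nonzeroRow) (drop-drop-≤ i≤j ℓ)))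
      where
      bool-identity : ∀ {a b c x y} → (a ∨ (b ∨ c)) ≡ true → ((a ∨ b) ≡ true → x ≡ not a) → ((b ∨ c) ≡ true → y ≡ not c) →
        (not c ∧ x) ≡ (not a ∧ y)
      bool-identity {true}  {_}     {true}  _ _  _  = refl
      bool-identity {true}  {_}     {false} _ x≡ _  rewrite x≡ refl = refl
      bool-identity {false} {true}  {true}  _ _  y≡ rewrite y≡ refl = refl
      bool-identity {false} {false} {true}  _ _  y≡ rewrite y≡ refl = refl
      bool-identity {false} {true}  {false} _ x≡ y≡ rewrite x≡ refl | y≡ refl = refl

    lastRow-codendriform₃ : (lastInRight ℓ j ∧ lastAnywhere (lastRow (leftBlock j X)) i)
                          ≡ (lastInRight ℓ i ∧ lastInRight (lastRow (rightBlock i X)) (j ∸ i))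
    lastRow-codendriform₃ = trans (cong (λ u → not u ∧ true) (nonzeroRow-take-split i≤j ℓ))
      (bool-identity {a} {b} {c} cover (λ b∨c → cong (λ r → zeroRow (take (j ∸ i) r)) (lastRow-rightBlock b∨c)))
      where
      bool-identity : ∀ {a b c y} → (a ∨ (b ∨ c)) ≡ true → ((b ∨ c) ≡ true → y ≡ not b) → (not (a ∨ b) ∧ true) ≡ (not a ∧ y)
      bool-identity {true}  {_}     {_}    _ _  = refl
      bool-identity {false} {true}  {_}    _ y≡ rewrite y≡ refl = refl
      bool-identity {false} {false} {true} _ y≡ rewrite y≡ refl = refl

-- The codendriform identities

module Codendriform {k : ℕ} {M : Mat k} {n : ℕ} (wf : WellFormed M n) (len : length M ≡ n) (1≤n : 1 ≤ n) where
  open Blocks wf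

  private
    M≢[] : M ≢ []
    M≢[] refl = <⇒≱ 1≤n (≤-reflexive (sym len))

    indices : List ℕ
    indices = range 0 n

    guard : SplitCondition k → ℕ → Bool
    guard c = splitGuard c M 0 n

    guard⇒ : ∀ {c j} → guard c j ≡ true →
      (0 < j) × (j < n) × (isSquare (leftBlock j M) ≡ true) × (isSquare (rightBlock j M) ≡ true)
    guard⇒ {c} {j} g with splitGuard⇒ {c = c} {X = M} {s = 0} {w = n} g
    ... | 0<j , j<n = 0<j , j<n , ∧≡true⇒ (trans (sym (isColDec≡ (<⇒≤ j<n))) isColDec-j)
      where
      isColDec-j : isColDec M j ≡ true
      isColDec-j = proj₁ (∧≡true⇒ {isColDec M j} (proj₂ (∧≡true⇒ {inRange 1 (n ∸ 1) j} g)))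

    blocks3 : ℕ → ℕ → Mat k × Mat k × Mat k
    blocks3 i j = leftBlock i M , middleBlock i j M , rightBlock j M

    leftGuard rightGuard : SplitCondition k → SplitCondition k → ℕ → ℕ → Bool
    leftGuard  cin cout i j = guard cout j ∧ splitGuard cin (leftBlock j M) 0 j i
    rightGuard cin cout i j = guard cout i ∧ splitGuard cin (rightBlock i M) i (n ∸ i) j

  ⊗I-Δ[c] : (c : SplitCondition k) (F : Mat k → Tensor2 k) → (F ⊗I) (Δ[ c ] M) ≡
    concatMap (λ j → when (guard c j) (map (λ q → proj₁ q , proj₂ q , rightBlock j M) (F (leftBlock j M)))) indices
  ⊗I-Δ[c] c F = trans (concatMap-Δ[c] c h {X = M} {w = n} 0 n len 1≤n ≤-refl)
    (concatMap-when-cong (λ j g → cong h (cpPair≡ (<⇒≤ (proj₁ (proj₂ (guard⇒ {c} {j} g)))))) indices)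
    where
    h : Mat k × Mat k → Tensor3 k
    h p = map (λ q → proj₁ q , proj₂ q , proj₂ p) (F (proj₁ p))

  I⊗-Δ[c] : (c : SplitCondition k) (F : Mat k → Tensor2 k) → (I⊗ F) (Δ[ c ] M) ≡
    concatMap (λ i → when (guard c i) (map (λ q → leftBlock i M , proj₁ q , proj₂ q) (F (rightBlock i M)))) indices
  I⊗-Δ[c] c F = trans (concatMap-Δ[c] c h {X = M} {w = n} 0 n len 1≤n ≤-refl)
    (concatMap-when-cong (λ i g → cong h (cpPair≡ {i} (<⇒≤ (proj₁ (proj₂ (guard⇒ {c} {i} g)))))) indices)
    where
    h : Mat k × Mat k → Tensor3 k
    h p = map (λ q → proj₁ p , proj₁ q , proj₂ q) (F (proj₂ p))

  ⊗I-nested : (cin cout : SplitCondition k) → (Δ[ cin ] ⊗I) (Δ[ cout ] M) ≡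
    concatMap (λ j → concatMap (λ i → when (leftGuard cin cout i j) [ blocks3 i j ]) indices) indices
  ⊗I-nested cin cout = trans (⊗I-Δ[c] cout Δ[ cin ]) (concatMap-cong (λ j →
    trans (when-cong (guard cout j) (inner j)) (when-concatMap-when (guard cout j) _ (λ i → [ blocks3 i j ]) indices)) indices)
    where
    inner : ∀ j → guard cout j ≡ true → map (λ q → proj₁ q , proj₂ q , rightBlock j M) (Δ[ cin ] (leftBlock j M)) ≡
      concatMap (λ i → when (splitGuard cin (leftBlock j M) 0 j i) [ blocks3 i j ]) indices
    inner j g with guard⇒ {cout} {j} g
    ... | 0<j , j<n , sqL , _ = begin
      map f (Δ[ cin ] (leftBlock j M))
        ≡⟨ map≡concatMap-[_] f _ ⟩
      concatMap (λ p → [ f p ]) (Δ[ cin ] (leftBlock j M))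
        ≡⟨ concatMap-Δ[c] cin (λ p → [ f p ]) {X = leftBlock j M} {w = j} 0 n (length-leftBlock {j} (<⇒≤ j<n) sqL) 0<j (<⇒≤ j<n) ⟩
      concatMap (λ i → when (splitGuard cin (leftBlock j M) 0 j i) [ f (cpPair (leftBlock j M) i) ]) indices
        ≡⟨ concatMap-when-cong (λ i g′ → cong (λ p → [ f p ])
             (cpPair-leftBlock wf {i} {j} (<⇒≤ (proj₂ (splitGuard⇒ {c = cin} {X = leftBlock j M} {s = 0} {w = j} g′))) (<⇒≤ j<n))) indices ⟩
      concatMap (λ i → when (splitGuard cin (leftBlock j M) 0 j i) [ blocks3 i j ]) indices ∎
      where
      open ≡-Reasoning
      f : Mat k × Mat k → Mat k × Mat k × Mat k
      f q = proj₁ q , proj₂ q , rightBlock j M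

  I⊗-nested : (cin cout : SplitCondition k) → (I⊗ Δ[ cin ]) (Δ[ cout ] M) ≡
    concatMap (λ i → concatMap (λ j → when (rightGuard cin cout i j) [ blocks3 i j ]) indices) indices
  I⊗-nested cin cout = trans (I⊗-Δ[c] cout Δ[ cin ]) (concatMap-cong (λ i →
    trans (when-cong (guard cout i) (inner i)) (when-concatMap-when (guard cout i) _ (λ j → [ blocks3 i j ]) indices)) indices)
    where
    inner : ∀ i → guard cout i ≡ true → map (λ q → leftBlock i M , proj₁ q , proj₂ q) (Δ[ cin ] (rightBlock i M)) ≡
      concatMap (λ j → when (splitGuard cin (rightBlock i M) i (n ∸ i) j) [ blocks3 i j ]) indices
    inner i g with guard⇒ {cout} {i} g
    ... | _ , i<n , _ , sqR = begin
      map f (Δ[ cin ] (rightBlock i M))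
        ≡⟨ map≡concatMap-[_] f _ ⟩
      concatMap (λ p → [ f p ]) (Δ[ cin ] (rightBlock i M))
        ≡⟨ concatMap-Δ[c] cin (λ p → [ f p ]) {X = rightBlock i M} {w = n ∸ i} i n (length-rightBlock i sqR) (m<n⇒0<n∸m i<n) (≤-reflexive i+[n∸i]≡n) ⟩
      concatMap (λ j → when (splitGuard cin (rightBlock i M) i (n ∸ i) j) [ f (cpPair (rightBlock i M) (j ∸ i)) ]) indices
        ≡⟨ concatMap-when-cong (λ j g′ → let i<j , j< = splitGuard⇒ {c = cin} {X = rightBlock i M} {s = i} {w = n ∸ i} g′ in
             cong (λ p → [ f p ]) (cpPair-rightBlock wf {i} {j} (<⇒≤ i<j) (<⇒≤ (subst (j <_) i+[n∸i]≡n j<)))) indices ⟩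
      concatMap (λ j → when (splitGuard cin (rightBlock i M) i (n ∸ i) j) [ blocks3 i j ]) indices ∎
      where
      open ≡-Reasoning
      f : Mat k × Mat k → Mat k × Mat k × Mat k
      f q = leftBlock i M , proj₁ q , proj₂ q
      i+[n∸i]≡n : i + (n ∸ i) ≡ n
      i+[n∸i]≡n = m+[n∸m]≡n (<⇒≤ i<n)

  private
    ranges-agree : ∀ i j → (inRange 1 (n ∸ 1) j ∧ inRange 1 (j ∸ 1) i) ≡ (inRange 1 (n ∸ 1) i ∧ inRange (i + 1) (n ∸ i ∸ 1) j)
    ranges-agree i j = ≡true⇔≡true⇒≡ to from
      where
      to : (inRange 1 (n ∸ 1) j ∧ inRange 1 (j ∸ 1) i) ≡ true → (inRange 1 (n ∸ 1) i ∧ inRange (i + 1) (n ∸ i ∸ 1) j) ≡ true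
      to e with ∧≡true⇒ {inRange 1 (n ∸ 1) j} e
      ... | rj , ri with inRange-suc⇒ {0} {n} rj | inRange-suc⇒ {0} {j} ri
      ... | _ , j<n | 0<i , i<j = cong₂ _∧_ (inRange-suc⁺ {0} {n} 0<i (<-trans i<j j<n))
        (inRange-suc⁺ {i} {n ∸ i} i<j (subst (j <_) (sym (m+[n∸m]≡n (<⇒≤ (<-trans i<j j<n)))) j<n))
      from : (inRange 1 (n ∸ 1) i ∧ inRange (i + 1) (n ∸ i ∸ 1) j) ≡ true → (inRange 1 (n ∸ 1) j ∧ inRange 1 (j ∸ 1) i) ≡ true
      from e with ∧≡true⇒ {inRange 1 (n ∸ 1) i} e
      ... | ri , rj with inRange-suc⇒ {0} {n} ri | inRange-suc⇒ {i} {n ∸ i} rj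
      ... | 0<i , i<n | i<j , j< = cong₂ _∧_ (inRange-suc⁺ {0} {n} (<-trans 0<i i<j) (subst (j <_) (m+[n∸m]≡n (<⇒≤ i<n)) j<))
        (inRange-suc⁺ {0} {j} 0<i i<j)

    guards-agree : (cin cout cin′ cout′ : SplitCondition k) →
      (∀ {i j} → i ≤ j → (cout (lastRow M) j ∧ cin (lastRow (leftBlock j M)) i) ≡ (cout′ (lastRow M) i ∧ cin′ (lastRow (rightBlock i M)) (j ∸ i))) →
      ∀ i j → leftGuard cin cout i j ≡ rightGuard cin′ cout′ i j
    guards-agree cin cout cin′ cout′ lastRow-agree i j = begin
      (inRange 1 (n ∸ 1) j ∧ (isColDec M j ∧ cout ℓ j)) ∧ (inRange 1 (j ∸ 1) i ∧ (isColDec L i ∧ cin (lastRow L) i))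
        ≡⟨ interchange (inRange 1 (n ∸ 1) j) _ (inRange 1 (j ∸ 1) i) _ ⟩
      (inRange 1 (n ∸ 1) j ∧ inRange 1 (j ∸ 1) i) ∧ ((isColDec M j ∧ cout ℓ j) ∧ (isColDec L i ∧ cin (lastRow L) i))
        ≡⟨ ∧-cong-guarded (ranges-agree i j) splits-agree ⟩
      (inRange 1 (n ∸ 1) i ∧ inRange (i + 1) (n ∸ i ∸ 1) j) ∧ ((isColDec M i ∧ cout′ ℓ i) ∧ (isColDec R (j ∸ i) ∧ cin′ (lastRow R) (j ∸ i)))
        ≡⟨ interchange (inRange 1 (n ∸ 1) i) (isColDec M i ∧ cout′ ℓ i) (inRange (i + 1) (n ∸ i ∸ 1) j) _ ⟨
      (inRange 1 (n ∸ 1) i ∧ (isColDec M i ∧ cout′ ℓ i)) ∧ (inRange (i + 1) (n ∸ i ∸ 1) j ∧ (isColDec R (j ∸ i) ∧ cin′ (lastRow R) (j ∸ i))) ∎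
      where
      open ≡-Reasoning
      ℓ = lastRow M
      L = leftBlock j M
      R = rightBlock i M
      splits-agree : (inRange 1 (n ∸ 1) j ∧ inRange 1 (j ∸ 1) i) ≡ true →
        ((isColDec M j ∧ cout ℓ j) ∧ (isColDec L i ∧ cin (lastRow L) i)) ≡ ((isColDec M i ∧ cout′ ℓ i) ∧ (isColDec R (j ∸ i) ∧ cin′ (lastRow R) (j ∸ i)))
      splits-agree e with ∧≡true⇒ {inRange 1 (n ∸ 1) j} e
      ... | rj , ri with inRange-suc⇒ {0} {n} rj | inRange-suc⇒ {0} {j} ri
      ... | _ , j<n | _ , i<j = begin
        (isColDec M j ∧ cout ℓ j) ∧ (isColDec L i ∧ cin (lastRow L) i)
          ≡⟨ interchange (isColDec M j) (cout ℓ j) (isColDec L i) _ ⟩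
        (isColDec M j ∧ isColDec L i) ∧ (cout ℓ j ∧ cin (lastRow L) i)
          ≡⟨ cong₂ _∧_ (ThreeBlocks.isColDec-assoc wf len (<⇒≤ i<j) (<⇒≤ j<n)) (lastRow-agree (<⇒≤ i<j)) ⟩
        (isColDec M i ∧ isColDec R (j ∸ i)) ∧ (cout′ ℓ i ∧ cin′ (lastRow R) (j ∸ i))
          ≡⟨ interchange (isColDec M i) (cout′ ℓ i) (isColDec R (j ∸ i)) _ ⟨
        (isColDec M i ∧ cout′ ℓ i) ∧ (isColDec R (j ∸ i) ∧ cin′ (lastRow R) (j ∸ i)) ∎

  coassociative : (cin cout cin′ cout′ : SplitCondition k) →
    (∀ {i j} → i ≤ j → (cout (lastRow M) j ∧ cin (lastRow (leftBlock j M)) i) ≡ (cout′ (lastRow M) i ∧ cin′ (lastRow (rightBlock i M)) (j ∸ i))) →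
    (Δ[ cin ] ⊗I) (Δ[ cout ] M) ↭ (I⊗ Δ[ cin′ ]) (Δ[ cout′ ] M)
  coassociative cin cout cin′ cout′ lastRow-agree = begin
    (Δ[ cin ] ⊗I) (Δ[ cout ] M)
      ≡⟨ ⊗I-nested cin cout ⟩
    concatMap (λ j → concatMap (λ i → when (leftGuard cin cout i j) [ blocks3 i j ]) indices) indices
      ≡⟨ concatMap-cong (λ j → concatMap-cong (λ i → cong (λ g → when g [ blocks3 i j ]) (guards-agree cin cout cin′ cout′ lastRow-agree i j)) indices) indices ⟩
    concatMap (λ j → concatMap (λ i → when (rightGuard cin′ cout′ i j) [ blocks3 i j ]) indices) indices
      ↭⟨ concatMap-comm (λ i j → when (rightGuard cin′ cout′ i j) [ blocks3 i j ]) indices indices ⟩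
    concatMap (λ i → concatMap (λ j → when (rightGuard cin′ cout′ i j) [ blocks3 i j ]) indices) indices
      ≡⟨ I⊗-nested cin′ cout′ ⟨
    (I⊗ Δ[ cin′ ]) (Δ[ cout′ ] M) ∎
    where open PermutationReasoning

  ⊗I-Δ̄ : (c : SplitCondition k) → (Δ̄ ⊗I) (Δ[ c ] M) ↭ (Δ[ lastAnywhere ] ⊗I) (Δ[ c ] M)
  ⊗I-Δ̄ c = ↭-trans (↭-reflexive (⊗I-Δ[c] c Δ̄))
    (↭-trans (concatMap-when-↭ Δ̄↭ indices) (↭-reflexive (sym (⊗I-Δ[c] c Δ[ lastAnywhere ]))))
    where
    Δ̄↭ : ∀ j → guard c j ≡ true → map (λ q → proj₁ q , proj₂ q , rightBlock j M) (Δ̄ (leftBlock j M)) ↭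
                                    map (λ q → proj₁ q , proj₂ q , rightBlock j M) (Δ[ lastAnywhere ] (leftBlock j M))
    Δ̄↭ j g with guard⇒ {c} {j} g
    ... | _ , j<n , sqL , _ = map⁺ _ (Δ̄↭Δ[lastAnywhere] (wf-leftBlock (<⇒≤ j<n)) (length-leftBlock {j} (<⇒≤ j<n) sqL))

  I⊗-Δ̄ : (c : SplitCondition k) → (I⊗ Δ̄) (Δ[ c ] M) ↭ (I⊗ Δ[ lastAnywhere ]) (Δ[ c ] M)
  I⊗-Δ̄ c = ↭-trans (↭-reflexive (I⊗-Δ[c] c Δ̄))
    (↭-trans (concatMap-when-↭ Δ̄↭ indices) (↭-reflexive (sym (I⊗-Δ[c] c Δ[ lastAnywhere ]))))
    where
    Δ̄↭ : ∀ i → guard c i ≡ true → map (λ q → leftBlock i M , proj₁ q , proj₂ q) (Δ̄ (rightBlock i M)) ↭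
                                    map (λ q → leftBlock i M , proj₁ q , proj₂ q) (Δ[ lastAnywhere ] (rightBlock i M))
    Δ̄↭ i g with guard⇒ {c} {i} g
    ... | _ , _ , _ , sqR = map⁺ _ (Δ̄↭Δ[lastAnywhere] (wf-rightBlock i) (length-rightBlock i sqR))

  private
    M-nonzero : filterᵇ nonzeroRow M ≡ M
    M-nonzero = filter-all (T? ∘ nonzeroRow) (All.map ≡true⇒T (nonzeroRows wf))

    isSquare-M : isSquare M ≡ true
    isSquare-M = ≡⇒≡ᵇ≡true (trans len (sym (width≡ M (rowLengths wf) M≢[])))
      where
      width≡ : (X : Mat k) → RowLengths X n → X ≢ [] → width X ≡ n
      width≡ []      _         X≢[] = ⊥-elim (X≢[] refl)
      width≡ (_ ∷ _) (e ∷ _) _    = e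

    cpPair-0 : cpPair M 0 ≡ (∅ , M)
    cpPair-0 = trans (cpPair≡ z≤n) (cong₂ _,_ (filterᵇ-nonzeroRow-empties M) (trans (cong (filterᵇ nonzeroRow) (map-id M)) M-nonzero))

    cpPair-n : cpPair M n ≡ (M , ∅)
    cpPair-n = trans (cpPair≡ ≤-refl) (cong₂ _,_
      (trans (cong (filterᵇ nonzeroRow) (map-id-local (All.map (λ e → take-all n _ (≤-reflexive e)) (rowLengths wf)))) M-nonzero)
      (trans (cong (filterᵇ nonzeroRow) (map-cong-local (All.map (λ e → drop-all n _ (≤-reflexive e)) (rowLengths wf))))
             (filterᵇ-nonzeroRow-empties M)))

    bothSquare : Mat k × Mat k → Bool
    bothSquare p = isSquare (proj₁ p) ∧ isSquare (proj₂ p)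

    isColDec-0 : isColDec M 0 ≡ true
    isColDec-0 = trans (cong bothSquare cpPair-0) isSquare-M

    isColDec-n : isColDec M n ≡ true
    isColDec-n = trans (cong bothSquare cpPair-n) (trans (∧-identityʳ _) isSquare-M)

    allSplits≡ : allSplits M ≡ 0 ∷ (innerSplits M ++ [ n ])
    allSplits≡ = begin
      upTo (suc (length M))                 ≡⟨ cong (upTo ∘ suc) len ⟩
      upTo (suc n)                          ≡⟨ upTo≡range (suc n) ⟩
      0 ∷ range 1 n                         ≡⟨ cong (0 ∷_) (range-1-∷ʳ 1≤n) ⟩
      0 ∷ (range 1 (n ∸ 1) ++ [ n ])        ≡⟨ cong (λ m → 0 ∷ (range 1 (m ∸ 1) ++ [ n ])) len ⟨
      0 ∷ (range 1 (length M ∸ 1) ++ [ n ]) ≡⟨ cong (λ is → 0 ∷ (is ++ [ n ])) (innerSplits≡range M) ⟨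
      0 ∷ (innerSplits M ++ [ n ])          ∎
      where open ≡-Reasoning

  Δ-decomposition : Δ M ↭ (∅ , M) ∷ Δ≺ M ++ Δ≻ M ++ (M , ∅) ∷ []
  Δ-decomposition = begin
    Δ M
      ≡⟨ cong (map (cpPair M) ∘ filterᵇ (isColDec M)) allSplits≡ ⟩
    map (cpPair M) (filterᵇ (isColDec M) (0 ∷ (innerSplits M ++ [ n ])))
      ≡⟨ cong (map (cpPair M)) (filter-accept (T? ∘ isColDec M) (≡true⇒T isColDec-0)) ⟩
    map (cpPair M) (0 ∷ filterᵇ (isColDec M) (innerSplits M ++ [ n ]))
      ≡⟨ cong (λ is → cpPair M 0 ∷ map (cpPair M) is) (trans (filter-++ (T? ∘ isColDec M) (innerSplits M) [ n ])
           (cong (filterᵇ (isColDec M) (innerSplits M) ++_) (filter-accept (T? ∘ isColDec M) (≡true⇒T isColDec-n)))) ⟩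
    cpPair M 0 ∷ map (cpPair M) (filterᵇ (isColDec M) (innerSplits M) ++ [ n ])
      ≡⟨ cong₂ (λ p ps → p ∷ ps) cpPair-0 (trans (map-++ (cpPair M) _ [ n ]) (cong₂ (λ ps q → ps ++ [ q ]) middle cpPair-n)) ⟩
    (∅ , M) ∷ Δ[ lastAnywhere ] M ++ [ (M , ∅) ]
      ↭⟨ prep (∅ , M) (++⁺ʳ [ (M , ∅) ] (↭-sym (Δ̄↭Δ[lastAnywhere] wf len))) ⟩
    (∅ , M) ∷ (Δ≺ M ++ Δ≻ M) ++ [ (M , ∅) ]
      ≡⟨ cong ((∅ , M) ∷_) (++-assoc (Δ≺ M) (Δ≻ M) _) ⟩
    (∅ , M) ∷ Δ≺ M ++ Δ≻ M ++ (M , ∅) ∷ [] ∎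
    where
    open PermutationReasoning
    middle : map (cpPair M) (filterᵇ (isColDec M) (innerSplits M)) ≡ Δ[ lastAnywhere ] M
    middle = cong (map (cpPair M)) (filterᵇ-cong (λ i → sym (∧-identityʳ (isColDec M i))) (innerSplits M))

  private
    ℓ≢0 : nonzeroRow (lastRow M) ≡ true
    ℓ≢0 = All-lastRow (nonzeroRows wf) M≢[]

    open module LastRow {i j : ℕ} (i≤j : i ≤ j) = LastRowConditions {X = M} ℓ≢0 i≤j

  codendriform₁ : (Δ≺ ⊗I) (Δ≺ M) ↭ (I⊗ Δ̄) (Δ≺ M)
  codendriform₁ = begin
    (Δ≺ ⊗I) (Δ≺ M)                                 ≡⟨ trans (⊗I-cong Δ≺≡Δ[lastInLeft] (Δ≺ M)) (cong (Δ[ lastInLeft ] ⊗I) (Δ≺≡Δ[lastInLeft] M)) ⟩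
    (Δ[ lastInLeft ] ⊗I) (Δ[ lastInLeft ] M)       ↭⟨ coassociative lastInLeft lastInLeft lastAnywhere lastInLeft lastRow-codendriform₁ ⟩
    (I⊗ Δ[ lastAnywhere ]) (Δ[ lastInLeft ] M)     ↭⟨ I⊗-Δ̄ lastInLeft ⟨
    (I⊗ Δ̄) (Δ[ lastInLeft ] M)                     ≡⟨ cong (I⊗ Δ̄) (Δ≺≡Δ[lastInLeft] M) ⟨
    (I⊗ Δ̄) (Δ≺ M)                                  ∎
    where open PermutationReasoning

  codendriform₂ : (Δ≻ ⊗I) (Δ≺ M) ↭ (I⊗ Δ≺) (Δ≻ M)
  codendriform₂ = begin
    (Δ≻ ⊗I) (Δ≺ M)                                 ≡⟨ trans (⊗I-cong Δ≻≡Δ[lastInRight] (Δ≺ M)) (cong (Δ[ lastInRight ] ⊗I) (Δ≺≡Δ[lastInLeft] M)) ⟩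
    (Δ[ lastInRight ] ⊗I) (Δ[ lastInLeft ] M)      ↭⟨ coassociative lastInRight lastInLeft lastInLeft lastInRight lastRow-codendriform₂ ⟩
    (I⊗ Δ[ lastInLeft ]) (Δ[ lastInRight ] M)      ≡⟨ trans (I⊗-cong Δ≺≡Δ[lastInLeft] (Δ≻ M)) (cong (I⊗ Δ[ lastInLeft ]) (Δ≻≡Δ[lastInRight] M)) ⟨
    (I⊗ Δ≺) (Δ≻ M)                                 ∎
    where open PermutationReasoning

  codendriform₃ : (Δ̄ ⊗I) (Δ≻ M) ↭ (I⊗ Δ≻) (Δ≻ M)
  codendriform₃ = begin
    (Δ̄ ⊗I) (Δ≻ M)                                  ≡⟨ cong (Δ̄ ⊗I) (Δ≻≡Δ[lastInRight] M) ⟩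
    (Δ̄ ⊗I) (Δ[ lastInRight ] M)                    ↭⟨ ⊗I-Δ̄ lastInRight ⟩
    (Δ[ lastAnywhere ] ⊗I) (Δ[ lastInRight ] M)    ↭⟨ coassociative lastAnywhere lastInRight lastInRight lastInRight lastRow-codendriform₃ ⟩
    (I⊗ Δ[ lastInRight ]) (Δ[ lastInRight ] M)     ≡⟨ trans (I⊗-cong Δ≻≡Δ[lastInRight] (Δ≻ M)) (cong (I⊗ Δ[ lastInRight ]) (Δ≻≡Δ[lastInRight] M)) ⟨
    (I⊗ Δ≻) (Δ≻ M)                                 ∎
    where open PermutationReasoning

proposition2p8 : (k : ℕ) → 1 ≤ k → (M : Mat k) → Packed k M → M ≢ ∅ →
    (Δ M ≈₂ ((∅ , M) ∷ Δ≺ M ++ Δ≻ M ++ (M , ∅) ∷ []))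
    × (((Δ≺ ⊗I) (Δ≺ M)) ≈₃ ((I⊗ Δ̄) (Δ≺ M)))
    × (((Δ≻ ⊗I) (Δ≺ M)) ≈₃ ((I⊗ Δ≺) (Δ≻ M)))
    × (((Δ̄ ⊗I) (Δ≻ M)) ≈₃ ((I⊗ Δ≻) (Δ≻ M)))
proposition2p8 k _ M packed M≢∅ = Δ-decomposition , codendriform₁ , codendriform₂ , codendriform₃
  where open Codendriform (Packed⇒WellFormed packed) refl (≢[]⇒1≤length M≢∅)
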